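{- Let $p$ be a prime and $A\in \mathbb{Z}^{m\times n}$ a matrix of rank $r$. The following statements are equivalent: (1) the columns of $A$ form a $p$-adic generating set for a subspace; (2) the rows of $A$ form a $p$-adic generating set for a subspace; (3) for all real vectors $x\in\mathbb{R}^n$, $y\in\mathbb{R}^m$ such that $y^\top A$ and $Ax$ are integral, $y^\top Ax$ is a $p$-adic rational; (4) every elementary divisor of $A$ is a power of $p$; (5) the GCD of the subdeterminants of $A$ of order $r$ is a power of $p$; (6) there exists a matrix $B$ with $p$-adic entries such that $ABA=A$.
   Context: A $p$-adic rational is a number of the form $a/p^k$ with $a,k$ integers and $k\geq 0$; a vector or matrix is $p$-adic if all its entries are. A finite set $S$ of integral vectors is a $p$-adic generating set for a subspace if every integral vector in the linear span of $S$ can be written as a linear combination of the vectors of $S$ with $p$-adic coefficients. The elementary divisors (invariant factors) of an integral matrix of rank $r$ are the diagonal entries $\delta_1,\ldots,\delta_r\geq 1$ (with $\delta_1\mid\delta_2\mid\cdots\mid\delta_r$) of its Smith normal form, i.e. the nonzero entries of the matrix obtained from it by unimodular row and column operations that has a leading diagonal $r\times r$ block $\operatorname{diag}(\delta_1,\dots,\delta_r)$ and zeros elsewhere. A power of $p$ means $p^k$ with $k\geq 0$ an integer.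
   Formalization: In condition (3) the vectors x and y range over ℚ^n and ℚ^m rather than over the real vectors ℝ^n and ℝ^m. -}

module Defs where

open import Data.Nat as ℕ using (ℕ; zero; suc; _≤_; _^_)
open import Data.Nat.Divisibility using (_∣_)
open import Data.Nat.Primality using (Prime)
open import Data.Integer as ℤ using (ℤ; +_)
open import Data.Integer.Divisibility as ℤD using ()
open import Data.Rational as ℚ using (ℚ; 0ℚ)
open import Data.Fin using (Fin; toℕ) renaming (zero to fz; suc to fs)
open import Data.Product using (Σ; ∃; _×_; _,_)
open import Relation.Binary.PropositionalEquality using (_≡_; _≢_)
open import Relation.Nullary using (¬_)

Mat : Set → ℕ → ℕ → Set
Mat A m n = Fin m → Fin n → A

Vecℤ : ℕ → Set
Vecℤ n = Fin n → ℤ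

Vecℚ : ℕ → Set
Vecℚ n = Fin n → ℚ

sumℤ : ∀ {n} → (Fin n → ℤ) → ℤ
sumℤ {zero} f = + 0
sumℤ {suc n} f = f fz ℤ.+ sumℤ (λ i → f (fs i))

sumℚ : ∀ {n} → (Fin n → ℚ) → ℚ
sumℚ {zero} f = 0ℚ
sumℚ {suc n} f = f fz ℚ.+ sumℚ (λ i → f (fs i))

toℚ : ℤ → ℚ
toℚ a = a ℚ./ 1

Aℚ : ∀ {m n} → Mat ℤ m n → Mat ℚ m n
Aℚ A i j = toℚ (A i j)

transpose : ∀ {A : Set} {m n} → Mat A m n → Mat A n m
transpose M j i = M i j

_*ℤ_ : ∀ {m k n} → Mat ℤ m k → Mat ℤ k n → Mat ℤ m n
(M *ℤ N) i j = sumℤ (λ l → M i l ℤ.* N l j)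

_*ℚ_ : ∀ {m k n} → Mat ℚ m k → Mat ℚ k n → Mat ℚ m n
(M *ℚ N) i j = sumℚ (λ l → M i l ℚ.* N l j)

_·ℚ_ : ∀ {m n} → Mat ℚ m n → Vecℚ n → Vecℚ m
(M ·ℚ x) i = sumℚ (λ j → M i j ℚ.* x j)

_ᵀ·ℚ_ : ∀ {m n} → Vecℚ m → Mat ℚ m n → Vecℚ n
(y ᵀ·ℚ M) j = sumℚ (λ i → y i ℚ.* M i j)

dotℚ : ∀ {n} → Vecℚ n → Vecℚ n → ℚ
dotℚ x y = sumℚ (λ i → x i ℚ.* y i)

idℤ : ∀ {n} → Mat ℤ n n
idℤ i j with toℕ i ℕ.≟ toℕ j
... | Relation.Nullary.yes _ = + 1
... | Relation.Nullary.no _ = + 0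

_≈M_ : ∀ {A : Set} {m n} → Mat A m n → Mat A m n → Set
M ≈M N = ∀ i j → M i j ≡ N i j

-- rank over ℚ (equivalently ℝ): maximal number of linearly independent columns
LinIndepCols : ∀ {m n r} → Mat ℚ m n → (Fin r → Fin n) → Set
LinIndepCols M s = ∀ (c : Vecℚ _) → (∀ i → sumℚ (λ k → c k ℚ.* M i (s k)) ≡ 0ℚ) → ∀ k → c k ≡ 0ℚ

HasRank : ∀ {m n} → Mat ℤ m n → ℕ → Set
HasRank {m} {n} A r =
  (Σ (Fin r → Fin n) λ s → LinIndepCols (Aℚ A) s) ×
  (∀ (s : Fin (suc r) → Fin n) → ¬ LinIndepCols (Aℚ A) s)

IsPadic : ℕ → ℚ → Set
IsPadic p q = Σ ℕ λ k → Σ ℤ λ a → q ℚ.* toℚ (+ (p ^ k)) ≡ toℚ a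

IsIntegral : ℚ → Set
IsIntegral q = Σ ℤ λ a → q ≡ toℚ a

IsPowerOf : ℕ → ℕ → Set
IsPowerOf p d = Σ ℕ λ k → d ≡ p ^ k

-- The columns of A form a p-adic generating set (for their span):
-- every integral vector in the (rational) span of the columns is a p-adic
-- combination of the columns.
ColsPadicGen : ℕ → ∀ {m n} → Mat ℤ m n → Set
ColsPadicGen p {m} {n} A =
  ∀ (v : Vecℤ m) →
  (Σ (Vecℚ n) λ λs → ∀ i → (Aℚ A ·ℚ λs) i ≡ toℚ (v i)) →
  Σ (Vecℚ n) λ μ → (∀ j → IsPadic p (μ j)) × (∀ i → (Aℚ A ·ℚ μ) i ≡ toℚ (v i))

RowsPadicGen : ℕ → ∀ {m n} → Mat ℤ m n → Set
RowsPadicGen p A = ColsPadicGen p (transpose A)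

DualPadic : ℕ → ∀ {m n} → Mat ℤ m n → Set
DualPadic p {m} {n} A =
  ∀ (x : Vecℚ n) (y : Vecℚ m) →
  (∀ j → IsIntegral ((y ᵀ·ℚ Aℚ A) j)) →
  (∀ i → IsIntegral ((Aℚ A ·ℚ x) i)) →
  IsPadic p (dotℚ y (Aℚ A ·ℚ x))

Unimodular : ∀ {n} → Mat ℤ n n → Set
Unimodular {n} U = Σ (Mat ℤ n n) λ U' → ((U *ℤ U') ≈M idℤ) × ((U' *ℤ U) ≈M idℤ)

IsSNF : ∀ {m n r} → Mat ℤ m n → (Fin r → ℕ) → Set
IsSNF {m} {n} {r} D δ =
  (∀ k → 1 ≤ δ k) ×
  (∀ k l → toℕ k ≤ toℕ l → δ k ∣ δ l) ×
  (∀ i j → toℕ i ≢ toℕ j → D i j ≡ + 0) ×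
  (∀ i j → toℕ i ≡ toℕ j → r ≤ toℕ i → D i j ≡ + 0) ×
  (∀ (k : Fin r) i j → toℕ i ≡ toℕ k → toℕ j ≡ toℕ k → D i j ≡ + (δ k))

ElemDivisors : ∀ {m n r} → Mat ℤ m n → (Fin r → ℕ) → Set
ElemDivisors {m} {n} A δ =
  Σ (Mat ℤ m m) λ U → Σ (Mat ℤ n n) λ V →
    Unimodular U × Unimodular V × IsSNF ((U *ℤ A) *ℤ V) δ

removeCol : ∀ {n} → Fin (suc n) → Fin n → Fin (suc n)
removeCol fz j = fs j
removeCol (fs c) fz = fz
removeCol (fs c) (fs j) = fs (removeCol c j)

sign : ℕ → ℤ
sign zero = + 1
sign (suc zero) = ℤ.- (+ 1)
sign (suc (suc k)) = sign k

det : ∀ {n} → Mat ℤ n n → ℤ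
det {zero} M = + 1
det {suc n} M = sumℤ (λ c → sign (toℕ c) ℤ.* (M fz c ℤ.* det (λ i j → M (fs i) (removeCol c j))))

-- subdeterminant of order r with row selection s and column selection t
-- (non-injective selections give determinant 0, so gcd is unaffected)
minor : ∀ {m n r} → Mat ℤ m n → (Fin r → Fin m) → (Fin r → Fin n) → ℤ
minor A s t = det (λ i j → A (s i) (t j))

IsGcdMinors : ∀ {m n} → Mat ℤ m n → ℕ → ℕ → Set
IsGcdMinors {m} {n} A r g =
  (∀ (s : Fin r → Fin m) (t : Fin r → Fin n) → (+ g) ℤD.∣ minor A s t) ×
  (∀ (d : ℕ) → (∀ (s : Fin r → Fin m) (t : Fin r → Fin n) → (+ d) ℤD.∣ minor A s t) → d ∣ g)

-- Every condition is invariant under multiplying A on either side by unimodular matrices; for the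
-- gcd of the r × r minors this holds because, by multilinearity of the determinant, the minors of
-- U A V are integral combinations of those of A.  By the Smith normal form it therefore suffices to
-- treat D = diag(δ₁, …, δ_r), where each condition says that every 1/δ_k is p-adic, i.e. that every
-- δ_k divides a power of p; the gcd of the r × r minors divides δ₁ ⋯ δ_r and is divisible by δ_r,
-- which all δ_k divide.  The rank r is the number of nonzero δ_k, as the leading minors of D are
-- nonzero and all larger minors vanish.
module Submission where

open import Defs
open import Algebra.Bundles using (CommutativeRing)
import Algebra.Properties.CommutativeSemigroup as CommSemigroupProperties
open import Level using (0ℓ)
open import Data.Nat as ℕ using (ℕ; zero; suc; _^_; s≤s; z≤n)
import Data.Nat.Properties as ℕP
import Data.Nat.Divisibility as ℕDiv
open ℕDiv using (_∣_; _∣?_; divides; ∣1⇒≡1; *-cancelʳ-∣)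
open import Data.Nat.GCD using (gcd; gcd[m,n]∣m; gcd[m,n]∣n; gcd-greatest)
open import Data.Nat.Primality using (Prime; prime⇒irreducible; prime⇒nonZero)
open import Data.Nat.Coprimality using (Coprime; coprime-divisor; 1-coprimeTo) renaming (sym to coprime-sym)
open import Data.Integer as ℤ using (ℤ; +_; -[1+_])
import Data.Integer.Properties as ℤP
import Data.Integer.Divisibility as ℤD
import Data.Integer.DivMod as ℤDivMod
import Data.Integer.Divisibility.Signed as ℤ∣
open ℤ∣ using () renaming (_∣_ to _∣ℤ_)
open import Data.Rational as ℚ using (ℚ; 0ℚ; 1ℚ)
import Data.Rational.Properties as ℚP
import Data.Rational.Literals as ℚL
open import Data.Rational.Solver using (module +-*-Solver)
open import Data.Fin using (Fin; toℕ; fromℕ; fromℕ<; inject≤) renaming (zero to fz; suc to fs)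
import Data.Fin.Properties as FinP
open import Data.Fin.Properties using (_≟_; all?; ¬∀⟶∃¬; punchIn-injective; punchInᵢ≢i; punchIn-punchOut)
open import Data.Fin.Base using (punchIn; punchOut)
open import Data.Fin.Permutation.Components using () renaming (transpose to swap; transpose-inverse to swap-inverse)
open import Data.Vec.Functional using (updateAt; _∷_)
open import Data.Vec.Functional.Properties using (updateAt-updates; updateAt-minimal)
open import Data.Integer.Tactic.RingSolver using (solve-∀)
open import Data.Empty using (⊥-elim)
open import Data.Product using (Σ; _×_; _,_; proj₁; proj₂)
open import Data.Sum using (_⊎_; inj₁; inj₂)
open import Function using (id; _∘_)
open import Function.Bundles using (_⇔_; mk⇔; Equivalence)
open import Function.Construct.Composition using (_⇔-∘_)
open import Function.Construct.Symmetry using (⇔-sym)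
open import Relation.Nullary using (¬_; Dec; yes; no; does)
open import Relation.Nullary.Decidable using (dec-true; dec-false)
open import Data.Bool using (if_then_else_)
open import Relation.Binary.PropositionalEquality
open import Relation.Binary.Definitions using (tri<; tri≈; tri>)
open import Relation.Binary.Bundles using (Setoid)
import Relation.Binary.Reasoning.Setoid as SetoidReasoning

module ℚSolver = +-*-Solver

-- Matrix algebra over a commutative ring

≈M-refl : ∀ {A : Set} {m n} {M : Mat A m n} → M ≈M M
≈M-refl i j = refl

≈M-sym : ∀ {A : Set} {m n} {M N : Mat A m n} → M ≈M N → N ≈M M
≈M-sym e i j = sym (e i j)

≈M-trans : ∀ {A : Set} {m n} {M N P : Mat A m n} → M ≈M N → N ≈M P → M ≈M P
≈M-trans e f i j = trans (e i j) (f i j)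

-- Ring laws are used as propositional equalities (for ℤ and ℚ the bundle equality is _≡_), and the
-- sum is given by its defining equations, so that the lemmas apply verbatim to sumℤ, sumℚ, _*ℤ_, _*ℚ_.
module MatrixAlgebra (R : CommutativeRing 0ℓ 0ℓ)
  (≈⇒≡ : ∀ {x y} → CommutativeRing._≈_ R x y → x ≡ y)
  (∑ : ∀ {n} → (Fin n → CommutativeRing.Carrier R) → CommutativeRing.Carrier R)
  (∑-nil : (f : Fin 0 → CommutativeRing.Carrier R) → ∑ f ≡ CommutativeRing.0# R)
  (∑-cons : ∀ {n} (f : Fin (suc n) → CommutativeRing.Carrier R) → ∑ f ≡ CommutativeRing._+_ R (f fz) (∑ (f ∘ fs)))
  where

  open CommutativeRing R
    using (Carrier; _+_; _*_; 0#; 1#; +-commutativeSemigroup; +-comm; *-comm; *-assoc; +-identityˡ; +-identityʳ;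
           *-identityˡ; *-identityʳ; zeroˡ; zeroʳ; distribˡ)
  open CommSemigroupProperties +-commutativeSemigroup using (interchange)
  open ≡-Reasoning

  ∑-cong : ∀ {n} {f g : Fin n → Carrier} → (∀ i → f i ≡ g i) → ∑ f ≡ ∑ g
  ∑-cong {zero} {f} {g} e = trans (∑-nil f) (sym (∑-nil g))
  ∑-cong {suc n} {f} {g} e =
    trans (∑-cons f) (trans (cong₂ _+_ (e fz) (∑-cong (e ∘ fs))) (sym (∑-cons g)))

  ∑-zero : ∀ {n} (f : Fin n → Carrier) → (∀ i → f i ≡ 0#) → ∑ f ≡ 0#
  ∑-zero {zero} f e = ∑-nil f
  ∑-zero {suc n} f e =
    trans (∑-cons f) (trans (cong₂ _+_ (e fz) (∑-zero (f ∘ fs) (e ∘ fs))) (≈⇒≡ (+-identityˡ 0#)))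

  ∑-+ : ∀ {n} (f g : Fin n → Carrier) → ∑ (λ i → f i + g i) ≡ ∑ f + ∑ g
  ∑-+ {zero} f g = begin
    ∑ (λ i → f i + g i) ≡⟨ ∑-nil _ ⟩
    0#                  ≡⟨ ≈⇒≡ (+-identityˡ 0#) ⟨
    0# + 0#             ≡⟨ cong₂ _+_ (∑-nil f) (∑-nil g) ⟨
    ∑ f + ∑ g           ∎
  ∑-+ {suc n} f g = begin
    ∑ (λ i → f i + g i)                            ≡⟨ ∑-cons _ ⟩
    (f fz + g fz) + ∑ (λ i → f (fs i) + g (fs i))  ≡⟨ cong (λ s → (f fz + g fz)  + s) (∑-+ (f ∘ fs) (g ∘ fs)) ⟩
    (f fz + g fz) + (∑ (f ∘ fs) + ∑ (g ∘ fs))      ≡⟨ ≈⇒≡ (interchange _ _ _ _) ⟩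
    (f fz + ∑ (f ∘ fs)) + (g fz + ∑ (g ∘ fs))      ≡⟨ cong₂ _+_ (∑-cons f) (∑-cons g) ⟨
    ∑ f + ∑ g                                      ∎

  *-distribˡ-∑ : ∀ {n} (c : Carrier) (f : Fin n → Carrier) → c * ∑ f ≡ ∑ (λ i → c * f i)
  *-distribˡ-∑ {zero} c f = trans (cong (c *_) (∑-nil f)) (trans (≈⇒≡ (zeroʳ c)) (sym (∑-nil _)))
  *-distribˡ-∑ {suc n} c f = begin
    c * ∑ f                          ≡⟨ cong (c *_) (∑-cons f) ⟩
    c * (f fz + ∑ (f ∘ fs))          ≡⟨ ≈⇒≡ (distribˡ c _ _) ⟩
    c * f fz + c * ∑ (f ∘ fs)        ≡⟨ cong (λ s → c * f fz  + s) (*-distribˡ-∑ c (f ∘ fs)) ⟩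
    c * f fz + ∑ (λ i → c * f (fs i)) ≡⟨ ∑-cons _ ⟨
    ∑ (λ i → c * f i)                ∎

  *-distribʳ-∑ : ∀ {n} (c : Carrier) (f : Fin n → Carrier) → ∑ f * c ≡ ∑ (λ i → f i * c)
  *-distribʳ-∑ c f =
    trans (≈⇒≡ (*-comm _ c)) (trans (*-distribˡ-∑ c f) (∑-cong (λ i → ≈⇒≡ (*-comm c (f i)))))

  ∑-comm : ∀ {m n} (f : Fin m → Fin n → Carrier) →
           ∑ (λ i → ∑ (λ j → f i j)) ≡ ∑ (λ j → ∑ (λ i → f i j))
  ∑-comm {zero} f = trans (∑-nil _) (sym (∑-zero _ (λ j → ∑-nil _)))
  ∑-comm {suc m} f = begin
    ∑ (λ i → ∑ (f i))                                  ≡⟨ ∑-cons _ ⟩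
    ∑ (f fz) + ∑ (λ i → ∑ (f (fs i)))                  ≡⟨ cong (λ s → ∑ (f fz)  + s) (∑-comm (f ∘ fs)) ⟩
    ∑ (f fz) + ∑ (λ j → ∑ (λ i → f (fs i) j))          ≡⟨ ∑-+ _ _ ⟨
    ∑ (λ j → f fz j + ∑ (λ i → f (fs i) j))            ≡⟨ ∑-cong (λ j → sym (∑-cons _)) ⟩
    ∑ (λ j → ∑ (λ i → f i j))                          ∎

  ∑-single : ∀ {n} (f : Fin n → Carrier) (k : Fin n) → (∀ i → i ≢ k → f i ≡ 0#) → ∑ f ≡ f k
  ∑-single {suc n} f fz e =
    trans (∑-cons f) (trans (cong (λ s → f fz  + s) (∑-zero _ (λ i → e (fs i) (λ ())))) (≈⇒≡ (+-identityʳ _)))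
  ∑-single {suc n} f (fs k) e =
    trans (∑-cons f) (trans (cong₂ _+_ (e fz (λ ())) (∑-single (f ∘ fs) k (λ i i≢k → e (fs i) (i≢k ∘ FinP.suc-injective))))
                            (≈⇒≡ (+-identityˡ _)))

  ∑-pair : ∀ {n} (f : Fin n → Carrier) (a b : Fin n) → a ≢ b →
           (∀ i → i ≢ a → i ≢ b → f i ≡ 0#) → ∑ f ≡ f a + f b
  ∑-pair {suc n} f fz fz a≢b e = ⊥-elim (a≢b refl)
  ∑-pair {suc n} f fz (fs b) a≢b e =
    trans (∑-cons f) (cong (λ s → f fz  + s) (∑-single (f ∘ fs) b (λ i i≢b → e (fs i) (λ ()) (i≢b ∘ FinP.suc-injective))))
  ∑-pair {suc n} f (fs a) fz a≢b e =
    trans (∑-cons f) (trans (cong (λ s → f fz  + s) (∑-single (f ∘ fs) a (λ i i≢a → e (fs i) (i≢a ∘ FinP.suc-injective) (λ ()))))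
                            (≈⇒≡ (+-comm _ _)))
  ∑-pair {suc n} f (fs a) (fs b) a≢b e =
    trans (∑-cons f) (trans (cong₂ _+_ (e fz (λ ()) (λ ()))
                                      (∑-pair (f ∘ fs) a b (a≢b ∘ cong fs)
                                        (λ i i≢a i≢b → e (fs i) (i≢a ∘ FinP.suc-injective) (i≢b ∘ FinP.suc-injective))))
                            (≈⇒≡ (+-identityˡ _)))

  infixl 7 _⊗_
  _⊗_ : ∀ {m k n} → Mat Carrier m k → Mat Carrier k n → Mat Carrier m n
  (M ⊗ N) i j = ∑ (λ l → M i l * N l j)

  ⊗-assoc : ∀ {m k l n} (A : Mat Carrier m k) (B : Mat Carrier k l) (C : Mat Carrier l n) →
            ((A ⊗ B) ⊗ C) ≈M (A ⊗ (B ⊗ C))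
  ⊗-assoc A B C i j = begin
    ∑ (λ t → ∑ (λ u → A i u * B u t) * C t j)    ≡⟨ ∑-cong (λ t → *-distribʳ-∑ _ _) ⟩
    ∑ (λ t → ∑ (λ u → (A i u * B u t) * C t j))  ≡⟨ ∑-comm _ ⟩
    ∑ (λ u → ∑ (λ t → (A i u * B u t) * C t j))  ≡⟨ ∑-cong (λ u → ∑-cong (λ t → ≈⇒≡ (*-assoc _ _ _))) ⟩
    ∑ (λ u → ∑ (λ t → A i u * (B u t * C t j)))  ≡⟨ ∑-cong (λ u → *-distribˡ-∑ _ _) ⟨
    ∑ (λ u → A i u * ∑ (λ t → B u t * C t j))    ∎

  ⊗-congˡ : ∀ {m k n} {A A' : Mat Carrier m k} (B : Mat Carrier k n) → A ≈M A' → (A ⊗ B) ≈M (A' ⊗ B)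
  ⊗-congˡ B e i j = ∑-cong (λ l → cong (_* B l j) (e i l))

  ⊗-congʳ : ∀ {m k n} (A : Mat Carrier m k) {B B' : Mat Carrier k n} → B ≈M B' → (A ⊗ B) ≈M (A ⊗ B')
  ⊗-congʳ A e i j = ∑-cong (λ l → cong (A i l *_) (e l j))

  ⊗-transpose : ∀ {m k n} (A : Mat Carrier m k) (B : Mat Carrier k n) →
                transpose (A ⊗ B) ≈M (transpose B ⊗ transpose A)
  ⊗-transpose A B i j = ∑-cong (λ l → ≈⇒≡ (*-comm _ _))

  IsIdentity : ∀ {n} → Mat Carrier n n → Set
  IsIdentity E = (∀ i → E i i ≡ 1#) × (∀ i j → i ≢ j → E i j ≡ 0#)

  ⊗-identityˡ : ∀ {m n} {E : Mat Carrier m m} → IsIdentity E → (A : Mat Carrier m n) → (E ⊗ A) ≈M A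
  ⊗-identityˡ {E = E} (diag , off) A i j =
    trans (∑-single _ i (λ l l≢i → trans (cong (_* A l j) (off i l (l≢i ∘ sym))) (≈⇒≡ (zeroˡ _))))
          (trans (cong (_* A i j) (diag i)) (≈⇒≡ (*-identityˡ _)))

  ⊗-identityʳ : ∀ {m n} {E : Mat Carrier n n} → IsIdentity E → (A : Mat Carrier m n) → (A ⊗ E) ≈M A
  ⊗-identityʳ {E = E} (diag , off) A i j =
    trans (∑-single _ j (λ l l≢j → trans (cong (A i l *_) (off l j l≢j)) (≈⇒≡ (zeroʳ _))))
          (trans (cong (A i j *_) (diag j)) (≈⇒≡ (*-identityʳ _)))

module ℤM = MatrixAlgebra ℤP.+-*-commutativeRing id sumℤ (λ _ → refl) (λ _ → refl)
module ℚM = MatrixAlgebra ℚP.+-*-commutativeRing id sumℚ (λ _ → refl) (λ _ → refl)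

-- Integer matrices as rational matrices

toℚ≡fromℤ : ∀ a → toℚ a ≡ ℚL.fromℤ a
toℚ≡fromℤ (+ m) = ℚP.normalize-coprime (coprime-sym (1-coprimeTo m))
toℚ≡fromℤ -[1+ m ] = cong ℚ.-_ (ℚP.normalize-coprime (coprime-sym (1-coprimeTo (suc m))))

toℚ-injective : ∀ {a b} → toℚ a ≡ toℚ b → a ≡ b
toℚ-injective {a} {b} e = cong ℚ.↥_ (trans (sym (toℚ≡fromℤ a)) (trans e (toℚ≡fromℤ b)))

-- On fractions with denominator 1, _+_ and _*_ of ℚ compute to (a * 1 + b * 1) / 1 and (a * b) / 1.
toℚ-+ : ∀ a b → toℚ (a ℤ.+ b) ≡ toℚ a ℚ.+ toℚ b
toℚ-+ a b = begin
  toℚ (a ℤ.+ b)                        ≡⟨ cong (ℚ._/ 1) (cong₂ ℤ._+_ (ℤP.*-identityʳ a) (ℤP.*-identityʳ b)) ⟨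
  toℚ (a ℤ.* + 1 ℤ.+ b ℤ.* + 1)        ≡⟨⟩
  ℚL.fromℤ a ℚ.+ ℚL.fromℤ b            ≡⟨ cong₂ ℚ._+_ (toℚ≡fromℤ a) (toℚ≡fromℤ b) ⟨
  toℚ a ℚ.+ toℚ b                      ∎
  where open ≡-Reasoning

toℚ-* : ∀ a b → toℚ (a ℤ.* b) ≡ toℚ a ℚ.* toℚ b
toℚ-* a b = sym (cong₂ ℚ._*_ (toℚ≡fromℤ a) (toℚ≡fromℤ b))

toℚ-∑ : ∀ {n} (f : Fin n → ℤ) → toℚ (sumℤ f) ≡ sumℚ (toℚ ∘ f)
toℚ-∑ {zero} f = refl
toℚ-∑ {suc n} f = trans (toℚ-+ (f fz) (sumℤ (f ∘ fs))) (cong (toℚ (f fz) ℚ.+_) (toℚ-∑ (f ∘ fs)))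

Aℚ-* : ∀ {m k n} (M : Mat ℤ m k) (N : Mat ℤ k n) → Aℚ (M *ℤ N) ≈M (Aℚ M *ℚ Aℚ N)
Aℚ-* M N i j = trans (toℚ-∑ (λ l → M i l ℤ.* N l j)) (ℚM.∑-cong (λ l → toℚ-* (M i l) (N l j)))

Aℚ-·ℚ : ∀ {m n} (M : Mat ℤ m n) (w : Vecℤ n) → Aℚ M ·ℚ (toℚ ∘ w) ≗ toℚ ∘ (λ i → sumℤ (λ j → M i j ℤ.* w j))
Aℚ-·ℚ M w i = trans (ℚM.∑-cong (λ j → sym (toℚ-* (M i j) (w j)))) (sym (toℚ-∑ (λ j → M i j ℤ.* w j)))

recip : (d : ℕ) → .{{ℕ.NonZero d}} → ℚ
recip (suc d) = ℚ.1/ ℚL.fromℤ (+ suc d)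

toℚ-*-recip : ∀ d .{{_ : ℕ.NonZero d}} → toℚ (+ d) ℚ.* recip d ≡ 1ℚ
toℚ-*-recip (suc d) = trans (cong (ℚ._* recip (suc d)) (toℚ≡fromℤ (+ suc d))) (ℚP.*-inverseʳ (ℚL.fromℤ (+ suc d)))

column : ∀ {n} → Vecℚ n → Mat ℚ n 1
column x j _ = x j

row : ∀ {n} → Vecℚ n → Mat ℚ 1 n
row y _ j = y j

·ℚ-* : ∀ {m k n} (M : Mat ℚ m k) (N : Mat ℚ k n) (x : Vecℚ n) → (M *ℚ N) ·ℚ x ≗ M ·ℚ (N ·ℚ x)
·ℚ-* M N x i = ℚM.⊗-assoc M N (column x) i fz

·ℚ-congˡ : ∀ {m n} {M N : Mat ℚ m n} (x : Vecℚ n) → M ≈M N → M ·ℚ x ≗ N ·ℚ x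
·ℚ-congˡ x e i = ℚM.⊗-congˡ (column x) e i fz

·ℚ-congʳ : ∀ {m n} (M : Mat ℚ m n) {x y : Vecℚ n} → x ≗ y → M ·ℚ x ≗ M ·ℚ y
·ℚ-congʳ M e i = ℚM.∑-cong (λ j → cong (M i j ℚ.*_) (e j))

ᵀ·ℚ-* : ∀ {m k n} (y : Vecℚ m) (M : Mat ℚ m k) (N : Mat ℚ k n) → y ᵀ·ℚ (M *ℚ N) ≗ (y ᵀ·ℚ M) ᵀ·ℚ N
ᵀ·ℚ-* y M N j = sym (ℚM.⊗-assoc (row y) M N fz j)

ᵀ·ℚ-congʳ : ∀ {m n} (y : Vecℚ m) {M N : Mat ℚ m n} → M ≈M N → y ᵀ·ℚ M ≗ y ᵀ·ℚ N
ᵀ·ℚ-congʳ y e j = ℚM.⊗-congʳ (row y) e fz j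

dotℚ-·ℚ : ∀ {m n} (y : Vecℚ m) (M : Mat ℚ m n) (x : Vecℚ n) → dotℚ y (M ·ℚ x) ≡ dotℚ (y ᵀ·ℚ M) x
dotℚ-·ℚ y M x = sym (ℚM.⊗-assoc (row y) M (column x) fz fz)

dotℚ-cong : ∀ {k} {x x' y y' : Vecℚ k} → x ≗ x' → y ≗ y' → dotℚ x y ≡ dotℚ x' y'
dotℚ-cong ex ey = ℚM.∑-cong (λ i → cong₂ ℚ._*_ (ex i) (ey i))

·ℚ-integral : ∀ {m n} (M : Mat ℤ m n) (x : Vecℚ n) → (∀ j → IsIntegral (x j)) → ∀ i → IsIntegral ((Aℚ M ·ℚ x) i)
·ℚ-integral M x x-int i = sumℤ (λ j → M i j ℤ.* proj₁ (x-int j)) ,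
  trans (ℚM.∑-cong (λ j → trans (cong (toℚ (M i j) ℚ.*_) (proj₂ (x-int j))) (sym (toℚ-* (M i j) (proj₁ (x-int j))))))
        (sym (toℚ-∑ (λ j → M i j ℤ.* proj₁ (x-int j))))

ᵀ·ℚ-integral : ∀ {m n} (y : Vecℚ m) (M : Mat ℤ m n) → (∀ i → IsIntegral (y i)) → ∀ j → IsIntegral ((y ᵀ·ℚ Aℚ M) j)
ᵀ·ℚ-integral y M y-int j = sumℤ (λ i → proj₁ (y-int i) ℤ.* M i j) ,
  trans (ℚM.∑-cong (λ i → trans (cong (ℚ._* toℚ (M i j)) (proj₂ (y-int i))) (sym (toℚ-* (proj₁ (y-int i)) (M i j)))))
        (sym (toℚ-∑ (λ i → proj₁ (y-int i) ℤ.* M i j)))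

-- p-adic rationals and prime powers

module _ (p : ℕ) where

  private
    P^ : ℕ → ℚ
    P^ k = toℚ (+ (p ^ k))

    P^-+ : ∀ k l → P^ (k ℕ.+ l) ≡ P^ k ℚ.* P^ l
    P^-+ k l = trans (cong (λ z → toℚ (+ z)) (ℕP.^-distribˡ-+-* p k l))
                     (trans (cong toℚ (ℤP.pos-* (p ^ k) (p ^ l))) (toℚ-* (+ (p ^ k)) (+ (p ^ l))))

  padic-toℚ : ∀ a → IsPadic p (toℚ a)
  padic-toℚ a = 0 , a , ℚP.*-identityʳ (toℚ a)

  padic-+ : ∀ a b → IsPadic p a → IsPadic p b → IsPadic p (a ℚ.+ b)
  padic-+ a b (k , x , ax) (l , y , by) = k ℕ.+ l , x ℤ.* + (p ^ l) ℤ.+ y ℤ.* + (p ^ k) , (begin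
    (a ℚ.+ b) ℚ.* P^ (k ℕ.+ l)                      ≡⟨ cong ((a ℚ.+ b) ℚ.*_) (P^-+ k l) ⟩
    (a ℚ.+ b) ℚ.* (P^ k ℚ.* P^ l)                   ≡⟨ ℚSolver.solve 4 (λ a b u v → (a :+ b) :* (u :* v) := (a :* u) :* v :+ (b :* v) :* u)
                                                         refl a b (P^ k) (P^ l) ⟩
    (a ℚ.* P^ k) ℚ.* P^ l ℚ.+ (b ℚ.* P^ l) ℚ.* P^ k ≡⟨ cong₂ (λ u v → u ℚ.* P^ l ℚ.+ v ℚ.* P^ k) ax by ⟩
    toℚ x ℚ.* P^ l ℚ.+ toℚ y ℚ.* P^ k               ≡⟨ cong₂ ℚ._+_ (toℚ-* x (+ (p ^ l))) (toℚ-* y (+ (p ^ k))) ⟨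
    toℚ (x ℤ.* + (p ^ l)) ℚ.+ toℚ (y ℤ.* + (p ^ k)) ≡⟨ toℚ-+ (x ℤ.* + (p ^ l)) (y ℤ.* + (p ^ k)) ⟨
    toℚ (x ℤ.* + (p ^ l) ℤ.+ y ℤ.* + (p ^ k))       ∎)
    where
    open ≡-Reasoning
    open ℚSolver

  padic-* : ∀ a b → IsPadic p a → IsPadic p b → IsPadic p (a ℚ.* b)
  padic-* a b (k , x , ax) (l , y , by) = k ℕ.+ l , x ℤ.* y , (begin
    (a ℚ.* b) ℚ.* P^ (k ℕ.+ l)     ≡⟨ cong ((a ℚ.* b) ℚ.*_) (P^-+ k l) ⟩
    (a ℚ.* b) ℚ.* (P^ k ℚ.* P^ l)  ≡⟨ ℚSolver.solve 4 (λ a b u v → (a :* b) :* (u :* v) := (a :* u) :* (b :* v)) refl a b (P^ k) (P^ l) ⟩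
    (a ℚ.* P^ k) ℚ.* (b ℚ.* P^ l)  ≡⟨ cong₂ ℚ._*_ ax by ⟩
    toℚ x ℚ.* toℚ y                ≡⟨ toℚ-* x y ⟨
    toℚ (x ℤ.* y)                  ∎)
    where
    open ≡-Reasoning
    open ℚSolver

  padic-∑ : ∀ {n} (f : Fin n → ℚ) → (∀ i → IsPadic p (f i)) → IsPadic p (sumℚ f)
  padic-∑ {zero} f f-padic = padic-toℚ (+ 0)
  padic-∑ {suc n} f f-padic = padic-+ (f fz) (sumℚ (f ∘ fs)) (f-padic fz) (padic-∑ (f ∘ fs) (f-padic ∘ fs))

  padic-·ℚ : ∀ {m n} (M : Mat ℤ m n) (x : Vecℚ n) → (∀ j → IsPadic p (x j)) → ∀ i → IsPadic p ((Aℚ M ·ℚ x) i)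
  padic-·ℚ M x x-padic i = padic-∑ _ (λ j → padic-* (Aℚ M i j) (x j) (padic-toℚ (M i j)) (x-padic j))

  padic-*ℚ : ∀ {m k n} (M : Mat ℚ m k) (N : Mat ℚ k n) →
             (∀ i j → IsPadic p (M i j)) → (∀ i j → IsPadic p (N i j)) → ∀ i j → IsPadic p ((M *ℚ N) i j)
  padic-*ℚ M N M-padic N-padic i j = padic-∑ _ (λ l → padic-* (M i l) (N l j) (M-padic i l) (N-padic l j))

  padic-by-power : ∀ {d} x a → IsPowerOf p d → x ℚ.* toℚ (+ d) ≡ toℚ a → IsPadic p x
  padic-by-power x a (k , refl) xd≡a = k , a , xd≡a

  prime-power-divisor : Prime p → ∀ k d → d ∣ p ^ k → IsPowerOf p d
  prime-power-divisor p-prime zero d d∣1 = 0 , ∣1⇒≡1 d∣1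
  prime-power-divisor p-prime (suc k) d d∣p^k+1 with p ∣? d
  ... | yes (divides q refl) = let (j , q≡p^j) = prime-power-divisor p-prime k q q∣p^k in
                               suc j , trans (cong (ℕ._* p) q≡p^j) (ℕP.*-comm (p ^ j) p)
    where
    instance _ = prime⇒nonZero p-prime
    q∣p^k : q ∣ p ^ k
    q∣p^k = *-cancelʳ-∣ p (subst (q ℕ.* p ∣_) (ℕP.*-comm p (p ^ k)) d∣p^k+1)
  ... | no p∤d = prime-power-divisor p-prime k d (coprime-divisor d⊥p d∣p^k+1)
    where
    d⊥p : Coprime d p
    d⊥p {c} (c∣d , c∣p) with prime⇒irreducible p-prime c∣p
    ... | inj₁ c≡1 = c≡1
    ... | inj₂ c≡p = ⊥-elim (p∤d (subst (_∣ d) c≡p c∣d))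

  IsPowerOf-* : ∀ {a b} → IsPowerOf p a → IsPowerOf p b → IsPowerOf p (a ℕ.* b)
  IsPowerOf-* (k , refl) (l , refl) = k ℕ.+ l , sym (ℕP.^-distribˡ-+-* p k l)

  inverse-padic⇒IsPowerOf : Prime p → ∀ {d q} → toℚ (+ d) ℚ.* q ≡ 1ℚ → IsPadic p q → IsPowerOf p d
  inverse-padic⇒IsPowerOf p-prime {d} {q} dq≡1 (k , a , qp^k≡a) =
    prime-power-divisor p-prime k d (divides ℤ.∣ a ∣ (begin
      p ^ k                    ≡⟨ cong ℤ.∣_∣ (toℚ-injective {+ (p ^ k)} {+ d ℤ.* a} p^k≡da) ⟩
      ℤ.∣ + d ℤ.* a ∣          ≡⟨ ℤP.abs-* (+ d) a ⟩
      d ℕ.* ℤ.∣ a ∣            ≡⟨ ℕP.*-comm d ℤ.∣ a ∣ ⟩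
      ℤ.∣ a ∣ ℕ.* d            ∎))
    where
    open ≡-Reasoning
    p^k≡da : toℚ (+ (p ^ k)) ≡ toℚ (+ d ℤ.* a)
    p^k≡da = begin
      P^ k                                ≡⟨ ℚP.*-identityˡ _ ⟨
      1ℚ ℚ.* P^ k                         ≡⟨ cong (ℚ._* P^ k) dq≡1 ⟨
      (toℚ (+ d) ℚ.* q) ℚ.* P^ k          ≡⟨ ℚP.*-assoc (toℚ (+ d)) q (P^ k) ⟩
      toℚ (+ d) ℚ.* (q ℚ.* P^ k)          ≡⟨ cong (toℚ (+ d) ℚ.*_) qp^k≡a ⟩
      toℚ (+ d) ℚ.* toℚ a                 ≡⟨ toℚ-* (+ d) a ⟨
      toℚ (+ d ℤ.* a)                     ∎

-- Determinants

removeCol≡punchIn : ∀ {n} (c : Fin (suc n)) (j : Fin n) → removeCol c j ≡ punchIn c j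
removeCol≡punchIn fz j = refl
removeCol≡punchIn (fs c) fz = refl
removeCol≡punchIn (fs c) (fs j) = cong fs (removeCol≡punchIn c j)

removeCol-≢ : ∀ {n} (c : Fin (suc n)) (j : Fin n) → removeCol c j ≢ c
removeCol-≢ c j = subst (_≢ c) (sym (removeCol≡punchIn c j)) (punchInᵢ≢i c j)

removeCol-injective : ∀ {n} (c : Fin (suc n)) {j j' : Fin n} → removeCol c j ≡ removeCol c j' → j ≡ j'
removeCol-injective c {j} {j'} e =
  punchIn-injective c j j' (trans (sym (removeCol≡punchIn c j)) (trans e (removeCol≡punchIn c j')))

removeCol-< : ∀ {n} (c : Fin (suc n)) (j : Fin n) → toℕ j ℕ.< toℕ c → toℕ (removeCol c j) ≡ toℕ j
removeCol-< (fs c) fz j<c = refl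
removeCol-< (fs c) (fs j) (s≤s j<c) = cong suc (removeCol-< c j j<c)

removeCol-≥ : ∀ {n} (c : Fin (suc n)) (j : Fin n) → toℕ c ℕ.≤ toℕ j → toℕ (removeCol c j) ≡ suc (toℕ j)
removeCol-≥ fz j c≤j = refl
removeCol-≥ (fs c) (fs j) (s≤s c≤j) = cong suc (removeCol-≥ c j c≤j)

record RemoveColPreimage {n} (c b : Fin (suc n)) : Set where
  field
    index : Fin n
    hits : removeCol c index ≡ b
    misses : ∀ j → j ≢ index → removeCol c j ≢ b

removeCol-preimage : ∀ {n} (c b : Fin (suc n)) → c ≢ b → RemoveColPreimage c b
removeCol-preimage c b c≢b = record { index = b' ; hits = hits ; misses = misses }
  where
  b' = punchOut c≢b
  hits : removeCol c b' ≡ b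
  hits = trans (removeCol≡punchIn c b') (punchIn-punchOut c≢b)
  misses : ∀ j → j ≢ b' → removeCol c j ≢ b
  misses j j≢b' e = j≢b' (removeCol-injective c (trans e (sym hits)))

laplaceMinor : ∀ {n} → Mat ℤ (suc n) (suc n) → Fin (suc n) → Mat ℤ n n
laplaceMinor M c i j = M (fs i) (removeCol c j)

laplaceTerm : ∀ {n} → Mat ℤ (suc n) (suc n) → Fin (suc n) → ℤ
laplaceTerm M c = sign (toℕ c) ℤ.* (M fz c ℤ.* det (laplaceMinor M c))

det-cong : ∀ {n} {M N : Mat ℤ n n} → M ≈M N → det M ≡ det N
det-cong {zero} e = refl
det-cong {suc n} {M} {N} e = ℤM.∑-cong (λ c →
  cong₂ (λ a d → sign (toℕ c) ℤ.* (a ℤ.* d)) (e fz c) (det-cong (λ i j → e (fs i) (removeCol c j))))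

sign-suc : ∀ k → sign (suc k) ≡ ℤ.- sign k
sign-suc zero = refl
sign-suc (suc zero) = refl
sign-suc (suc (suc k)) = sign-suc k

det-combination : ∀ {n} (M M₁ M₂ : Mat ℤ (suc n) (suc n)) (x y : ℤ) →
  (∀ c → laplaceTerm M c ≡ x ℤ.* laplaceTerm M₁ c ℤ.+ y ℤ.* laplaceTerm M₂ c) →
  det M ≡ x ℤ.* det M₁ ℤ.+ y ℤ.* det M₂
det-combination M M₁ M₂ x y terms = begin
  sumℤ (laplaceTerm M)                                                     ≡⟨ ℤM.∑-cong terms ⟩
  sumℤ (λ c → x ℤ.* laplaceTerm M₁ c ℤ.+ y ℤ.* laplaceTerm M₂ c)
    ≡⟨ ℤM.∑-+ (λ c → x ℤ.* laplaceTerm M₁ c) (λ c → y ℤ.* laplaceTerm M₂ c) ⟩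
  sumℤ (λ c → x ℤ.* laplaceTerm M₁ c) ℤ.+ sumℤ (λ c → y ℤ.* laplaceTerm M₂ c)
    ≡⟨ cong₂ ℤ._+_ (ℤM.*-distribˡ-∑ x (laplaceTerm M₁)) (ℤM.*-distribˡ-∑ y (laplaceTerm M₂)) ⟨
  x ℤ.* det M₁ ℤ.+ y ℤ.* det M₂                                            ∎
  where open ≡-Reasoning

module _ {n} (M M₁ M₂ : Mat ℤ (suc n) (suc n)) (x y : ℤ) (c : Fin (suc n)) where

  private
    s = sign (toℕ c)

  laplaceTerm-linear-entry :
    M fz c ≡ x ℤ.* M₁ fz c ℤ.+ y ℤ.* M₂ fz c →
    det (laplaceMinor M c) ≡ det (laplaceMinor M₁ c) → det (laplaceMinor M c) ≡ det (laplaceMinor M₂ c) →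
    laplaceTerm M c ≡ x ℤ.* laplaceTerm M₁ c ℤ.+ y ℤ.* laplaceTerm M₂ c
  laplaceTerm-linear-entry entry minor₁ minor₂ = begin
    s ℤ.* (M fz c ℤ.* d)                                                  ≡⟨ cong (λ a → s ℤ.* (a ℤ.* d)) entry ⟩
    s ℤ.* ((x ℤ.* a₁ ℤ.+ y ℤ.* a₂) ℤ.* d)                                 ≡⟨ distribute s x y a₁ a₂ d ⟩
    x ℤ.* (s ℤ.* (a₁ ℤ.* d)) ℤ.+ y ℤ.* (s ℤ.* (a₂ ℤ.* d))
      ≡⟨ cong₂ (λ d₁ d₂ → x ℤ.* (s ℤ.* (a₁ ℤ.* d₁)) ℤ.+ y ℤ.* (s ℤ.* (a₂ ℤ.* d₂))) minor₁ minor₂ ⟩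
    x ℤ.* laplaceTerm M₁ c ℤ.+ y ℤ.* laplaceTerm M₂ c                     ∎
    where
    open ≡-Reasoning
    d = det (laplaceMinor M c)
    a₁ = M₁ fz c
    a₂ = M₂ fz c
    distribute : ∀ s x y a₁ a₂ d →
                 s ℤ.* ((x ℤ.* a₁ ℤ.+ y ℤ.* a₂) ℤ.* d) ≡ x ℤ.* (s ℤ.* (a₁ ℤ.* d)) ℤ.+ y ℤ.* (s ℤ.* (a₂ ℤ.* d))
    distribute = solve-∀

  laplaceTerm-linear-minor :
    M fz c ≡ M₁ fz c → M fz c ≡ M₂ fz c →
    det (laplaceMinor M c) ≡ x ℤ.* det (laplaceMinor M₁ c) ℤ.+ y ℤ.* det (laplaceMinor M₂ c) →
    laplaceTerm M c ≡ x ℤ.* laplaceTerm M₁ c ℤ.+ y ℤ.* laplaceTerm M₂ c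
  laplaceTerm-linear-minor entry₁ entry₂ minor = begin
    s ℤ.* (a ℤ.* det (laplaceMinor M c))                                  ≡⟨ cong (λ d → s ℤ.* (a ℤ.* d)) minor ⟩
    s ℤ.* (a ℤ.* (x ℤ.* d₁ ℤ.+ y ℤ.* d₂))                                 ≡⟨ distribute s x y a d₁ d₂ ⟩
    x ℤ.* (s ℤ.* (a ℤ.* d₁)) ℤ.+ y ℤ.* (s ℤ.* (a ℤ.* d₂))
      ≡⟨ cong₂ (λ a₁ a₂ → x ℤ.* (s ℤ.* (a₁ ℤ.* d₁)) ℤ.+ y ℤ.* (s ℤ.* (a₂ ℤ.* d₂))) entry₁ entry₂ ⟩
    x ℤ.* laplaceTerm M₁ c ℤ.+ y ℤ.* laplaceTerm M₂ c                     ∎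
    where
    open ≡-Reasoning
    a = M fz c
    d₁ = det (laplaceMinor M₁ c)
    d₂ = det (laplaceMinor M₂ c)
    distribute : ∀ s x y a d₁ d₂ →
                 s ℤ.* (a ℤ.* (x ℤ.* d₁ ℤ.+ y ℤ.* d₂)) ≡ x ℤ.* (s ℤ.* (a ℤ.* d₁)) ℤ.+ y ℤ.* (s ℤ.* (a ℤ.* d₂))
    distribute = solve-∀

det-linear-col : ∀ {n} (M M₁ M₂ : Mat ℤ n n) (b : Fin n) (x y : ℤ) →
  (∀ i j → j ≢ b → M i j ≡ M₁ i j) → (∀ i j → j ≢ b → M i j ≡ M₂ i j) →
  (∀ i → M i b ≡ x ℤ.* M₁ i b ℤ.+ y ℤ.* M₂ i b) →
  det M ≡ x ℤ.* det M₁ ℤ.+ y ℤ.* det M₂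
det-linear-col {suc n} M M₁ M₂ b x y M≈M₁ M≈M₂ col-b = det-combination M M₁ M₂ x y term
  where
  term : ∀ c → laplaceTerm M c ≡ x ℤ.* laplaceTerm M₁ c ℤ.+ y ℤ.* laplaceTerm M₂ c
  term c with c ≟ b
  ... | yes refl = laplaceTerm-linear-entry M M₁ M₂ x y c (col-b fz) (minor≡ M≈M₁) (minor≡ M≈M₂)
    where
    minor≡ : ∀ {N} → (∀ i j → j ≢ c → M i j ≡ N i j) → det (laplaceMinor M c) ≡ det (laplaceMinor N c)
    minor≡ M≈N = det-cong (λ i j → M≈N (fs i) (removeCol c j) (removeCol-≢ c j))
  ... | no c≢b = laplaceTerm-linear-minor M M₁ M₂ x y c (M≈M₁ fz c c≢b) (M≈M₂ fz c c≢b)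
    (det-linear-col (laplaceMinor M c) (laplaceMinor M₁ c) (laplaceMinor M₂ c) index x y
      (λ i j j≢b' → M≈M₁ (fs i) (removeCol c j) (misses j j≢b'))
      (λ i j j≢b' → M≈M₂ (fs i) (removeCol c j) (misses j j≢b'))
      (λ i → subst (λ k → M (fs i) k ≡ x ℤ.* M₁ (fs i) k ℤ.+ y ℤ.* M₂ (fs i) k) (sym hits) (col-b (fs i))))
    where open RemoveColPreimage (removeCol-preimage c b c≢b)

det-linear-row : ∀ {n} (M M₁ M₂ : Mat ℤ n n) (a : Fin n) (x y : ℤ) →
  (∀ i j → i ≢ a → M i j ≡ M₁ i j) → (∀ i j → i ≢ a → M i j ≡ M₂ i j) →
  (∀ j → M a j ≡ x ℤ.* M₁ a j ℤ.+ y ℤ.* M₂ a j) →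
  det M ≡ x ℤ.* det M₁ ℤ.+ y ℤ.* det M₂
det-linear-row {suc n} M M₁ M₂ fz x y M≈M₁ M≈M₂ row-a = det-combination M M₁ M₂ x y (λ c →
  laplaceTerm-linear-entry M M₁ M₂ x y c (row-a c)
    (det-cong (λ i j → M≈M₁ (fs i) (removeCol c j) (λ ())))
    (det-cong (λ i j → M≈M₂ (fs i) (removeCol c j) (λ ()))))
det-linear-row {suc n} M M₁ M₂ (fs a) x y M≈M₁ M≈M₂ row-a = det-combination M M₁ M₂ x y (λ c →
  laplaceTerm-linear-minor M M₁ M₂ x y c (M≈M₁ fz c (λ ())) (M≈M₂ fz c (λ ()))
    (det-linear-row (laplaceMinor M c) (laplaceMinor M₁ c) (laplaceMinor M₂ c) a x y
      (λ i j i≢a → M≈M₁ (fs i) (removeCol c j) (i≢a ∘ FinP.suc-injective))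
      (λ i j i≢a → M≈M₂ (fs i) (removeCol c j) (i≢a ∘ FinP.suc-injective))
      (λ j → row-a (removeCol c j))))

det-additive-col : ∀ {n} (M M₁ M₂ : Mat ℤ n n) (b : Fin n) →
  (∀ i j → j ≢ b → M i j ≡ M₁ i j) → (∀ i j → j ≢ b → M i j ≡ M₂ i j) →
  (∀ i → M i b ≡ M₁ i b ℤ.+ M₂ i b) →
  det M ≡ det M₁ ℤ.+ det M₂
det-additive-col M M₁ M₂ b M≈M₁ M≈M₂ col-b =
  trans (det-linear-col M M₁ M₂ b (+ 1) (+ 1) M≈M₁ M≈M₂ (λ i → trans (col-b i) (sym (one*+one* (M₁ i b) (M₂ i b)))))
        (one*+one* (det M₁) (det M₂))
  where
  one*+one* : ∀ a b → + 1 ℤ.* a ℤ.+ + 1 ℤ.* b ≡ a ℤ.+ b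
  one*+one* a b = cong₂ ℤ._+_ (ℤP.*-identityˡ a) (ℤP.*-identityˡ b)

det-zero-col : ∀ {n} (M : Mat ℤ n n) (b : Fin n) → (∀ i → M i b ≡ + 0) → det M ≡ + 0
det-zero-col M b zero-b = det-linear-col M M M b (+ 0) (+ 0) (λ _ _ _ → refl) (λ _ _ _ → refl) zero-b

det-zero-row : ∀ {n} (M : Mat ℤ n n) (a : Fin n) → (∀ j → M a j ≡ + 0) → det M ≡ + 0
det-zero-row M a zero-a = det-linear-row M M M a (+ 0) (+ 0) (λ _ _ _ → refl) (λ _ _ _ → refl) zero-a

removeCol-adjacent : ∀ {n} (c : Fin (suc n)) (j j' : Fin n) →
  toℕ (removeCol c j') ≡ suc (toℕ (removeCol c j)) → toℕ j' ≡ suc (toℕ j)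
removeCol-adjacent c j j' adj with toℕ j ℕP.<? toℕ c | toℕ j' ℕP.<? toℕ c
... | yes j<c | yes j'<c = trans (sym (removeCol-< c j' j'<c)) (trans adj (cong suc (removeCol-< c j j<c)))
... | no j≮c | no j'≮c =
  ℕP.suc-injective (trans (sym (removeCol-≥ c j' (ℕP.≮⇒≥ j'≮c))) (trans adj (cong suc (removeCol-≥ c j (ℕP.≮⇒≥ j≮c)))))
... | yes j<c | no j'≮c = ⊥-elim (ℕP.<-irrefl j≡j' (ℕP.<-≤-trans j<c (ℕP.≮⇒≥ j'≮c)))
  where
  j≡j' : toℕ j ≡ toℕ j'
  j≡j' = ℕP.suc-injective (trans (cong suc (sym (removeCol-< c j j<c)))
                            (trans (sym adj) (removeCol-≥ c j' (ℕP.≮⇒≥ j'≮c))))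
... | no j≮c | yes j'<c = ⊥-elim (ℕP.<-irrefl refl (ℕP.<-trans j'<c (ℕP.≤-<-trans (ℕP.≮⇒≥ j≮c) j<j')))
  where
  j'≡2+j : toℕ j' ≡ suc (suc (toℕ j))
  j'≡2+j = trans (sym (removeCol-< c j' j'<c)) (trans adj (cong suc (removeCol-≥ c j (ℕP.≮⇒≥ j≮c))))
  j<j' : toℕ j ℕ.< toℕ j'
  j<j' = subst (toℕ j ℕ.<_) (sym j'≡2+j) (ℕP.m<n⇒m<1+n (ℕP.n<1+n _))

laplaceMinor-adjacent-equal-cols : ∀ {n} (M : Mat ℤ (suc n) (suc n)) (b b' : Fin (suc n)) →
  toℕ b' ≡ suc (toℕ b) → (∀ i → M i b ≡ M i b') → laplaceMinor M b ≈M laplaceMinor M b'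
laplaceMinor-adjacent-equal-cols M b b' adj b≈b' i j with ℕP.<-cmp (toℕ j) (toℕ b)
... | tri< j<b _ _ = cong (M (fs i)) (FinP.toℕ-injective
  (trans (removeCol-< b j j<b) (sym (removeCol-< b' j (ℕP.<-trans j<b (subst (toℕ b ℕ.<_) (sym adj) (ℕP.n<1+n _)))))))
... | tri> _ _ b<j = cong (M (fs i)) (FinP.toℕ-injective
  (trans (removeCol-≥ b j (ℕP.<⇒≤ b<j)) (sym (removeCol-≥ b' j (subst (ℕ._≤ toℕ j) (sym adj) b<j)))))
... | tri≈ _ j≡b _ = trans (cong (M (fs i)) at-b) (trans (sym (b≈b' (fs i))) (cong (M (fs i)) (sym at-b')))
  where
  at-b : removeCol b j ≡ b'
  at-b = FinP.toℕ-injective (trans (removeCol-≥ b j (ℕP.≤-reflexive (sym j≡b))) (trans (cong suc j≡b) (sym adj)))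
  at-b' : removeCol b' j ≡ b
  at-b' = FinP.toℕ-injective (trans (removeCol-< b' j (subst (toℕ j ℕ.<_) (sym adj) (ℕP.≤-reflexive (cong suc j≡b)))) j≡b)

-- The two Laplace terms at b and b' = b + 1 cancel (equal minors, opposite signs);
-- every other minor again has two adjacent equal columns.
det-adjacent-equal-cols : ∀ {n} (M : Mat ℤ n n) (b b' : Fin n) →
  toℕ b' ≡ suc (toℕ b) → (∀ i → M i b ≡ M i b') → det M ≡ + 0
det-adjacent-equal-cols {suc n} M b b' adj b≈b' = trans (ℤM.∑-pair (laplaceTerm M) b b' b≢b' others) cancel
  where
  b≢b' : b ≢ b'
  b≢b' b≡b' = ℕP.1+n≢n (sym (trans (cong toℕ b≡b') adj))
  others : ∀ c → c ≢ b → c ≢ b' → laplaceTerm M c ≡ + 0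
  others c c≢b c≢b' = trans (cong (λ d → sign (toℕ c) ℤ.* (M fz c ℤ.* d)) minor-zero)
                            (trans (cong (sign (toℕ c) ℤ.*_) (ℤP.*-zeroʳ (M fz c))) (ℤP.*-zeroʳ (sign (toℕ c))))
    where
    open RemoveColPreimage (removeCol-preimage c b c≢b) renaming (index to j; hits to j↦b)
    open RemoveColPreimage (removeCol-preimage c b' c≢b') renaming (index to j'; hits to j'↦b')
    minor-zero : det (laplaceMinor M c) ≡ + 0
    minor-zero = det-adjacent-equal-cols (laplaceMinor M c) j j'
      (removeCol-adjacent c j j' (subst₂ (λ x y → toℕ y ≡ suc (toℕ x)) (sym j↦b) (sym j'↦b') adj))
      (λ i → trans (cong (M (fs i)) j↦b) (trans (b≈b' (fs i)) (cong (M (fs i)) (sym j'↦b'))))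
  cancel : laplaceTerm M b ℤ.+ laplaceTerm M b' ≡ + 0
  cancel = begin
    s ℤ.* (M fz b ℤ.* d) ℤ.+ sign (toℕ b') ℤ.* (M fz b' ℤ.* det (laplaceMinor M b'))
      ≡⟨ cong₂ (λ t a → s ℤ.* (M fz b ℤ.* d) ℤ.+ t ℤ.* (a ℤ.* det (laplaceMinor M b')))
               (trans (cong sign adj) (sign-suc (toℕ b))) (sym (b≈b' fz)) ⟩
    s ℤ.* (M fz b ℤ.* d) ℤ.+ ℤ.- s ℤ.* (M fz b ℤ.* det (laplaceMinor M b'))
      ≡⟨ cong (λ d' → s ℤ.* (M fz b ℤ.* d) ℤ.+ ℤ.- s ℤ.* (M fz b ℤ.* d'))
              (sym (det-cong (laplaceMinor-adjacent-equal-cols M b b' adj b≈b'))) ⟩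
    s ℤ.* (M fz b ℤ.* d) ℤ.+ ℤ.- s ℤ.* (M fz b ℤ.* d) ≡⟨ opposite s (M fz b) d ⟩
    + 0 ∎
    where
    open ≡-Reasoning
    s = sign (toℕ b)
    d = det (laplaceMinor M b)
    opposite : ∀ s a d → s ℤ.* (a ℤ.* d) ℤ.+ ℤ.- s ℤ.* (a ℤ.* d) ≡ + 0
    opposite = solve-∀

setCol : ∀ {m n} → Fin n → Vecℤ m → Mat ℤ m n → Mat ℤ m n
setCol b u M i = updateAt (M i) b (λ _ → u i)

setCol-at : ∀ {m n} (b : Fin n) (u : Vecℤ m) (M : Mat ℤ m n) i → setCol b u M i b ≡ u i
setCol-at b u M i = updateAt-updates b (M i)

setCol-off : ∀ {m n} (b : Fin n) (u : Vecℤ m) (M : Mat ℤ m n) i j → j ≢ b → setCol b u M i j ≡ M i j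
setCol-off b u M i j j≢b = updateAt-minimal j b (M i) j≢b

setRow : ∀ {m n} → Fin m → Vecℤ n → Mat ℤ m n → Mat ℤ m n
setRow a u M = updateAt M a (λ _ → u)

setRow-at : ∀ {m n} (a : Fin m) (u : Vecℤ n) (M : Mat ℤ m n) j → setRow a u M a j ≡ u j
setRow-at a u M j = cong-app (updateAt-updates a M) j

setRow-off : ∀ {m n} (a : Fin m) (u : Vecℤ n) (M : Mat ℤ m n) i j → i ≢ a → setRow a u M i j ≡ M i j
setRow-off a u M i j i≢a = cong-app (updateAt-minimal i a M i≢a) j

swap-matchˡ : ∀ {n} (i j : Fin n) → swap i j i ≡ j
swap-matchˡ i j with i ≟ i
... | yes _ = refl
... | no i≢i = ⊥-elim (i≢i refl)

swap-matchʳ : ∀ {n} (i j : Fin n) → swap i j j ≡ i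
swap-matchʳ i j with j ≟ i
... | yes j≡i = j≡i
... | no _ with j ≟ j
...   | yes _ = refl
...   | no j≢j = ⊥-elim (j≢j refl)

swap-other : ∀ {n} (i j k : Fin n) → k ≢ i → k ≢ j → swap i j k ≡ k
swap-other i j k k≢i k≢j with k ≟ i
... | yes k≡i = ⊥-elim (k≢i k≡i)
... | no _ with k ≟ j
...   | yes k≡j = ⊥-elim (k≢j k≡j)
...   | no _ = refl

≈M-by-cols : ∀ {A : Set} {m n} {M N : Mat A m n} (b b' : Fin n) →
  (∀ i → M i b ≡ N i b) → (∀ i → M i b' ≡ N i b') → (∀ i j → j ≢ b → j ≢ b' → M i j ≡ N i j) → M ≈M N
≈M-by-cols b b' at-b at-b' elsewhere i j with j ≟ b | j ≟ b'
... | yes refl | _ = at-b i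
... | no _ | yes refl = at-b' i
... | no j≢b | no j≢b' = elsewhere i j j≢b j≢b'

-- Expanding det P(x+y, x+y) = 0 by additivity in both columns leaves det P(x, y) + det P(y, x) = 0.
det-swap-adjacent-cols : ∀ {n} (M : Mat ℤ n n) (b b' : Fin n) → toℕ b' ≡ suc (toℕ b) →
  det (λ i j → M i (swap b b' j)) ≡ ℤ.- det M
det-swap-adjacent-cols {n} M b b' adj = begin
  det M'                                         ≡⟨ cancel-right (det M') (det M) ⟩
  (det M' ℤ.+ det M) ℤ.- det M                   ≡⟨ cong (ℤ._- det M) sum-zero ⟩
  + 0 ℤ.- det M                                  ≡⟨ ℤP.+-identityˡ (ℤ.- det M) ⟩
  ℤ.- det M                                      ∎
  where
  open ≡-Reasoning
  M' : Mat ℤ n n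
  M' i j = M i (swap b b' j)
  b'≢b : b' ≢ b
  b'≢b b'≡b = ℕP.1+n≢n (trans (sym adj) (cong toℕ b'≡b))
  x y : Vecℤ n
  x i = M i b
  y i = M i b'
  _+ᵥ_ : Vecℤ n → Vecℤ n → Vecℤ n
  (u +ᵥ v) i = u i ℤ.+ v i
  P : Vecℤ n → Vecℤ n → Mat ℤ n n
  P u v = setCol b u (setCol b' v M)
  P-b : ∀ u v i → P u v i b ≡ u i
  P-b u v i = setCol-at b u (setCol b' v M) i
  P-b' : ∀ u v i → P u v i b' ≡ v i
  P-b' u v i = trans (setCol-off b u (setCol b' v M) i b' b'≢b) (setCol-at b' v M i)
  P-off : ∀ u v i j → j ≢ b → j ≢ b' → P u v i j ≡ M i j
  P-off u v i j j≢b j≢b' = trans (setCol-off b u (setCol b' v M) i j j≢b) (setCol-off b' v M i j j≢b')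
  P-agreeˡ : ∀ u u' v i j → j ≢ b → P u v i j ≡ P u' v i j
  P-agreeˡ u u' v i j j≢b = trans (setCol-off b u (setCol b' v M) i j j≢b) (sym (setCol-off b u' (setCol b' v M) i j j≢b))
  P-agreeʳ : ∀ u v v' i j → j ≢ b' → P u v i j ≡ P u v' i j
  P-agreeʳ u v v' i j j≢b' with j ≟ b
  ... | yes refl = trans (P-b u v i) (sym (P-b u v' i))
  ... | no j≢b = trans (P-off u v i j j≢b j≢b') (sym (P-off u v' i j j≢b j≢b'))
  additiveˡ : ∀ u₁ u₂ v → det (P (u₁ +ᵥ u₂) v) ≡ det (P u₁ v) ℤ.+ det (P u₂ v)
  additiveˡ u₁ u₂ v = det-additive-col (P (u₁ +ᵥ u₂) v) (P u₁ v) (P u₂ v) b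
    (P-agreeˡ (u₁ +ᵥ u₂) u₁ v) (P-agreeˡ (u₁ +ᵥ u₂) u₂ v)
    (λ i → trans (P-b (u₁ +ᵥ u₂) v i) (sym (cong₂ ℤ._+_ (P-b u₁ v i) (P-b u₂ v i))))
  additiveʳ : ∀ u v₁ v₂ → det (P u (v₁ +ᵥ v₂)) ≡ det (P u v₁) ℤ.+ det (P u v₂)
  additiveʳ u v₁ v₂ = det-additive-col (P u (v₁ +ᵥ v₂)) (P u v₁) (P u v₂) b'
    (P-agreeʳ u (v₁ +ᵥ v₂) v₁) (P-agreeʳ u (v₁ +ᵥ v₂) v₂)
    (λ i → trans (P-b' u (v₁ +ᵥ v₂) i) (sym (cong₂ ℤ._+_ (P-b' u v₁ i) (P-b' u v₂ i))))
  alternating : ∀ u → det (P u u) ≡ + 0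
  alternating u = det-adjacent-equal-cols (P u u) b b' adj (λ i → trans (P-b u u i) (sym (P-b' u u i)))
  P-x-y : P x y ≈M M
  P-x-y = ≈M-by-cols b b' (P-b x y) (P-b' x y) (P-off x y)
  P-y-x : P y x ≈M M'
  P-y-x = ≈M-by-cols b b' (λ i → trans (P-b y x i) (cong (M i) (sym (swap-matchˡ b b'))))
                          (λ i → trans (P-b' y x i) (cong (M i) (sym (swap-matchʳ b b'))))
                          (λ i j j≢b j≢b' → trans (P-off y x i j j≢b j≢b') (cong (M i) (sym (swap-other b b' j j≢b j≢b'))))
  regroup : ∀ c b → c ℤ.+ b ≡ (+ 0 ℤ.+ b) ℤ.+ (c ℤ.+ + 0)
  regroup = solve-∀
  sum-zero : det M' ℤ.+ det M ≡ + 0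
  sum-zero = begin
    det M' ℤ.+ det M                                                   ≡⟨ cong₂ ℤ._+_ (det-cong P-y-x) (det-cong P-x-y) ⟨
    det (P y x) ℤ.+ det (P x y)                                        ≡⟨ regroup (det (P y x)) (det (P x y)) ⟩
    (+ 0 ℤ.+ det (P x y)) ℤ.+ (det (P y x) ℤ.+ + 0)
      ≡⟨ cong₂ (λ z z' → (z ℤ.+ det (P x y)) ℤ.+ (det (P y x) ℤ.+ z')) (alternating x) (alternating y) ⟨
    (det (P x x) ℤ.+ det (P x y)) ℤ.+ (det (P y x) ℤ.+ det (P y y))    ≡⟨ cong₂ ℤ._+_ (additiveʳ x x y) (additiveʳ y x y) ⟨
    det (P x (x +ᵥ y)) ℤ.+ det (P y (x +ᵥ y))                          ≡⟨ additiveˡ x y (x +ᵥ y) ⟨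
    det (P (x +ᵥ y) (x +ᵥ y))                                          ≡⟨ alternating (x +ᵥ y) ⟩
    + 0                                                                ∎
  cancel-right : ∀ a b → a ≡ (a ℤ.+ b) ℤ.- b
  cancel-right = solve-∀

-- Swapping column b with its left neighbour moves the copy of column a one step closer.
det-equal-cols-at-distance : ∀ d {n} (M : Mat ℤ n n) (a b : Fin n) →
  toℕ b ≡ toℕ a ℕ.+ suc d → (∀ i → M i a ≡ M i b) → det M ≡ + 0
det-equal-cols-at-distance zero M a b b≡a+1 a≈b =
  det-adjacent-equal-cols M a b (trans b≡a+1 (ℕP.+-comm (toℕ a) 1)) a≈b
det-equal-cols-at-distance (suc d) {n} M a b b≡a+d+2 a≈b = begin
  det M          ≡⟨ ℤP.neg-involutive (det M) ⟨
  ℤ.- ℤ.- det M  ≡⟨ cong ℤ.-_ (det-swap-adjacent-cols M c b b≡c+1) ⟨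
  ℤ.- det M'     ≡⟨ cong ℤ.-_ (det-equal-cols-at-distance d M' a c c≡a+d+1 a≈c) ⟩
  + 0            ∎
  where
  open ≡-Reasoning
  c<n : toℕ a ℕ.+ suc d ℕ.< n
  c<n = ℕP.<-trans (ℕP.+-monoʳ-< (toℕ a) (ℕP.n<1+n (suc d))) (subst (ℕ._< n) b≡a+d+2 (FinP.toℕ<n b))
  c : Fin n
  c = fromℕ< c<n
  c≡a+d+1 : toℕ c ≡ toℕ a ℕ.+ suc d
  c≡a+d+1 = FinP.toℕ-fromℕ< c<n
  b≡c+1 : toℕ b ≡ suc (toℕ c)
  b≡c+1 = trans b≡a+d+2 (trans (ℕP.+-suc (toℕ a) (suc d)) (cong suc (sym c≡a+d+1)))
  M' : Mat ℤ n n
  M' i j = M i (swap c b j)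
  a≢c : a ≢ c
  a≢c a≡c = ℕP.m≢1+n+m (toℕ a) (trans (cong toℕ a≡c) (trans c≡a+d+1 (ℕP.+-comm (toℕ a) (suc d))))
  a≢b : a ≢ b
  a≢b a≡b = ℕP.m≢1+n+m (toℕ a) (trans (cong toℕ a≡b) (trans b≡a+d+2 (ℕP.+-comm (toℕ a) (suc (suc d)))))
  a≈c : ∀ i → M' i a ≡ M' i c
  a≈c i = trans (cong (M i) (swap-other c b a a≢c a≢b)) (trans (a≈b i) (cong (M i) (sym (swap-matchˡ c b))))

det-equal-cols : ∀ {n} (M : Mat ℤ n n) (a b : Fin n) → a ≢ b → (∀ i → M i a ≡ M i b) → det M ≡ + 0
det-equal-cols M a b a≢b a≈b with ℕP.<-cmp (toℕ a) (toℕ b)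
... | tri< a<b _ _ = det-equal-cols-at-distance (toℕ b ℕ.∸ suc (toℕ a)) M a b
                       (sym (trans (ℕP.+-suc (toℕ a) _) (ℕP.m+[n∸m]≡n a<b))) a≈b
... | tri≈ _ a≡b _ = ⊥-elim (a≢b (FinP.toℕ-injective a≡b))
... | tri> _ _ b<a = det-equal-cols-at-distance (toℕ a ℕ.∸ suc (toℕ b)) M b a
                       (sym (trans (ℕP.+-suc (toℕ b) _) (ℕP.m+[n∸m]≡n b<a))) (sym ∘ a≈b)

setCol-setCol : ∀ {m n} (b : Fin n) (u v : Vecℤ m) (M : Mat ℤ m n) → setCol b u (setCol b v M) ≈M setCol b u M
setCol-setCol b u v M i j with j ≟ b
... | yes refl = trans (setCol-at b u (setCol b v M) i) (sym (setCol-at b u M i))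
... | no j≢b = trans (setCol-off b u (setCol b v M) i j j≢b) (trans (setCol-off b v M i j j≢b) (sym (setCol-off b u M i j j≢b)))

setRow-setRow : ∀ {m n} (a : Fin m) (u v : Vecℤ n) (M : Mat ℤ m n) → setRow a u (setRow a v M) ≈M setRow a u M
setRow-setRow a u v M i j with i ≟ a
... | yes refl = trans (setRow-at a u (setRow a v M) j) (sym (setRow-at a u M j))
... | no i≢a = trans (setRow-off a u (setRow a v M) i j i≢a) (trans (setRow-off a v M i j i≢a) (sym (setRow-off a u M i j i≢a)))

det-∑-col : ∀ {n} K (M : Mat ℤ n n) (b : Fin n) (X : Fin K → Vecℤ n) (w : Fin K → ℤ) →
  (∀ i → M i b ≡ sumℤ (λ l → w l ℤ.* X l i)) →
  det M ≡ sumℤ (λ l → w l ℤ.* det (setCol b (X l) M))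
det-∑-col zero M b X w col-b = det-zero-col M b col-b
det-∑-col (suc K) M b X w col-b = begin
  det M
    ≡⟨ det-linear-col M (setCol b (X fz) M) (setCol b Y M) b (w fz) (+ 1)
         (λ i j j≢b → sym (setCol-off b (X fz) M i j j≢b)) (λ i j j≢b → sym (setCol-off b Y M i j j≢b))
         (λ i → trans (col-b i) (cong₂ ℤ._+_ (cong (w fz ℤ.*_) (sym (setCol-at b (X fz) M i)))
                                             (trans (sym (ℤP.*-identityˡ (Y i))) (cong (+ 1 ℤ.*_) (sym (setCol-at b Y M i)))))) ⟩
  first ℤ.+ + 1 ℤ.* det (setCol b Y M)                            ≡⟨ cong (λ z → first ℤ.+ z) (ℤP.*-identityˡ _) ⟩
  first ℤ.+ det (setCol b Y M)
    ≡⟨ cong (λ z → first ℤ.+ z) (det-∑-col K (setCol b Y M) b (X ∘ fs) (w ∘ fs) (setCol-at b Y M)) ⟩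
  first ℤ.+ sumℤ (λ l → w (fs l) ℤ.* det (setCol b (X (fs l)) (setCol b Y M)))
    ≡⟨ cong (λ z → first ℤ.+ z) (ℤM.∑-cong (λ l → cong (w (fs l) ℤ.*_) (det-cong (setCol-setCol b (X (fs l)) Y M)))) ⟩
  sumℤ (λ l → w l ℤ.* det (setCol b (X l) M))                     ∎
  where
  open ≡-Reasoning
  Y : Vecℤ _
  Y i = sumℤ (λ l → w (fs l) ℤ.* X (fs l) i)
  first = w fz ℤ.* det (setCol b (X fz) M)

det-∑-row : ∀ {n} K (M : Mat ℤ n n) (a : Fin n) (X : Fin K → Vecℤ n) (w : Fin K → ℤ) →
  (∀ j → M a j ≡ sumℤ (λ l → w l ℤ.* X l j)) →
  det M ≡ sumℤ (λ l → w l ℤ.* det (setRow a (X l) M))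
det-∑-row zero M a X w row-a = det-zero-row M a row-a
det-∑-row (suc K) M a X w row-a = begin
  det M
    ≡⟨ det-linear-row M (setRow a (X fz) M) (setRow a Y M) a (w fz) (+ 1)
         (λ i j i≢a → sym (setRow-off a (X fz) M i j i≢a)) (λ i j i≢a → sym (setRow-off a Y M i j i≢a))
         (λ j → trans (row-a j) (cong₂ ℤ._+_ (cong (w fz ℤ.*_) (sym (setRow-at a (X fz) M j)))
                                             (trans (sym (ℤP.*-identityˡ (Y j))) (cong (+ 1 ℤ.*_) (sym (setRow-at a Y M j)))))) ⟩
  first ℤ.+ + 1 ℤ.* det (setRow a Y M)                            ≡⟨ cong (λ z → first ℤ.+ z) (ℤP.*-identityˡ _) ⟩
  first ℤ.+ det (setRow a Y M)
    ≡⟨ cong (λ z → first ℤ.+ z) (det-∑-row K (setRow a Y M) a (X ∘ fs) (w ∘ fs) (setRow-at a Y M)) ⟩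
  first ℤ.+ sumℤ (λ l → w (fs l) ℤ.* det (setRow a (X (fs l)) (setRow a Y M)))
    ≡⟨ cong (λ z → first ℤ.+ z) (ℤM.∑-cong (λ l → cong (w (fs l) ℤ.*_) (det-cong (setRow-setRow a (X (fs l)) Y M)))) ⟩
  sumℤ (λ l → w l ℤ.* det (setRow a (X l) M))                     ∎
  where
  open ≡-Reasoning
  Y : Vecℤ _
  Y j = sumℤ (λ l → w (fs l) ℤ.* X (fs l) j)
  first = w fz ℤ.* det (setRow a (X fz) M)

∣ℤ0 : ∀ {d} → d ∣ℤ + 0
∣ℤ0 = ℤ∣.divides (+ 0) refl

∣-∑ : ∀ {n} {d : ℤ} (f : Fin n → ℤ) → (∀ l → d ∣ℤ f l) → d ∣ℤ sumℤ f
∣-∑ {zero} f d∣f = ∣ℤ0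
∣-∑ {suc n} f d∣f = ℤ∣.∣m∣n⇒∣m+n (d∣f fz) (∣-∑ (f ∘ fs) (d∣f ∘ fs))

-- Columns of B W are combinations of columns of B: replace them one at a time, from the left,
-- expanding each new column by multilinearity.
module _ {r K : ℕ} (B : Mat ℤ r K) (W : Mat ℤ K r) {d : ℤ} (d∣B : ∀ (τ : Fin r → Fin K) → d ∣ℤ det (λ i j → B i (τ j))) where

  private
    mixed : ℕ → (Fin r → Fin K) → Mat ℤ r r
    mixed k τ i j = if does (toℕ j ℕ.<? k) then (B *ℤ W) i j else B i (τ j)

    mixed-< : ∀ {k} τ i j → toℕ j ℕ.< k → mixed k τ i j ≡ (B *ℤ W) i j
    mixed-< {k} τ i j j<k rewrite dec-true (toℕ j ℕ.<? k) j<k = refl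

    mixed-≮ : ∀ {k} τ i j → ¬ toℕ j ℕ.< k → mixed k τ i j ≡ B i (τ j)
    mixed-≮ {k} τ i j j≮k rewrite dec-false (toℕ j ℕ.<? k) j≮k = refl

    d∣mixed : ∀ k → k ℕ.≤ r → ∀ τ → d ∣ℤ det (mixed k τ)
    d∣mixed zero _ τ = subst (d ∣ℤ_) (det-cong (λ i j → sym (mixed-≮ τ i j ℕP.n≮0))) (d∣B τ)
    d∣mixed (suc k) k<r τ = subst (d ∣ℤ_) (sym expand)
      (∣-∑ (λ l → W l b ℤ.* det (setCol b (λ i → B i l) (mixed (suc k) τ)))
           (λ l → ℤ∣.∣n⇒∣m*n (W l b) (subst (d ∣ℤ_) (det-cong (λ i j → sym (replaced l i j)))
                                                      (d∣mixed k (ℕP.<⇒≤ k<r) (τ[b≔ l ])))))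
      where
      b : Fin r
      b = fromℕ< k<r
      b≡k : toℕ b ≡ k
      b≡k = FinP.toℕ-fromℕ< k<r
      τ[b≔_] : Fin K → Fin r → Fin K
      τ[b≔ l ] = updateAt τ b (λ _ → l)
      expand : det (mixed (suc k) τ) ≡ sumℤ (λ l → W l b ℤ.* det (setCol b (λ i → B i l) (mixed (suc k) τ)))
      expand = det-∑-col K (mixed (suc k) τ) b (λ l i → B i l) (λ l → W l b) (λ i →
        trans (mixed-< τ i b (ℕP.≤-reflexive (cong suc b≡k))) (ℤM.∑-cong (λ l → ℤP.*-comm (B i l) (W l b))))
      replaced : ∀ l i j → setCol b (λ i → B i l) (mixed (suc k) τ) i j ≡ mixed k τ[b≔ l ] i j
      replaced l i j with j ≟ b
      ... | yes refl = trans (setCol-at b (λ i → B i l) (mixed (suc k) τ) i) (sym (trans (mixed-≮ τ[b≔ l ] i b (ℕP.<-irrefl b≡k))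
                                                        (cong (B i) (updateAt-updates b τ))))
      ... | no j≢b with toℕ j ℕP.<? k
      ...   | yes j<k = trans (setCol-off b (λ i → B i l) (mixed (suc k) τ) i j j≢b)
                              (trans (mixed-< τ i j (ℕP.m<n⇒m<1+n j<k)) (sym (mixed-< τ[b≔ l ] i j j<k)))
      ...   | no j≮k = trans (setCol-off b (λ i → B i l) (mixed (suc k) τ) i j j≢b) (trans (mixed-≮ τ i j j≮k+1)
                                   (sym (trans (mixed-≮ τ[b≔ l ] i j j≮k) (cong (B i) (updateAt-minimal j b τ j≢b)))))
        where
        j≮k+1 : ¬ toℕ j ℕ.< suc k
        j≮k+1 j<k+1 = j≢b (FinP.toℕ-injective (trans (ℕP.≤-antisym (ℕP.≤-pred j<k+1) (ℕP.≮⇒≥ j≮k)) (sym b≡k)))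

  ∣-det-*ʳ′ : (Fin r → Fin K) → d ∣ℤ det (B *ℤ W)
  ∣-det-*ʳ′ τ = subst (d ∣ℤ_) (det-cong (λ i j → mixed-< τ i j (FinP.toℕ<n j))) (d∣mixed r ℕP.≤-refl τ)

∣-det-*ʳ : ∀ {r K} (B : Mat ℤ r K) (W : Mat ℤ K r) {d : ℤ} →
  (∀ (τ : Fin r → Fin K) → d ∣ℤ det (λ i j → B i (τ j))) → d ∣ℤ det (B *ℤ W)
∣-det-*ʳ {zero} B W d∣B = ∣-det-*ʳ′ B W d∣B (λ ())
∣-det-*ʳ {suc r} {zero} B W {d} d∣B = subst (d ∣ℤ_) (sym (det-zero-col (B *ℤ W) fz (λ i → refl))) ∣ℤ0
∣-det-*ʳ {suc r} {suc K} B W d∣B = ∣-det-*ʳ′ B W d∣B (λ _ → fz)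

module _ {r K : ℕ} (W : Mat ℤ r K) (B : Mat ℤ K r) {d : ℤ} (d∣B : ∀ (σ : Fin r → Fin K) → d ∣ℤ det (λ i j → B (σ i) j)) where

  private
    mixed : ℕ → (Fin r → Fin K) → Mat ℤ r r
    mixed k σ i j = if does (toℕ i ℕ.<? k) then (W *ℤ B) i j else B (σ i) j

    mixed-< : ∀ {k} σ i j → toℕ i ℕ.< k → mixed k σ i j ≡ (W *ℤ B) i j
    mixed-< {k} σ i j i<k rewrite dec-true (toℕ i ℕ.<? k) i<k = refl

    mixed-≮ : ∀ {k} σ i j → ¬ toℕ i ℕ.< k → mixed k σ i j ≡ B (σ i) j
    mixed-≮ {k} σ i j i≮k rewrite dec-false (toℕ i ℕ.<? k) i≮k = refl

    d∣mixed : ∀ k → k ℕ.≤ r → ∀ σ → d ∣ℤ det (mixed k σ)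
    d∣mixed zero _ σ = subst (d ∣ℤ_) (det-cong (λ i j → sym (mixed-≮ σ i j ℕP.n≮0))) (d∣B σ)
    d∣mixed (suc k) k<r σ = subst (d ∣ℤ_) (sym expand)
      (∣-∑ (λ l → W a l ℤ.* det (setRow a (B l) (mixed (suc k) σ)))
           (λ l → ℤ∣.∣n⇒∣m*n (W a l) (subst (d ∣ℤ_) (det-cong (λ i j → sym (replaced l i j)))
                                                      (d∣mixed k (ℕP.<⇒≤ k<r) (σ[a≔ l ])))))
      where
      a : Fin r
      a = fromℕ< k<r
      a≡k : toℕ a ≡ k
      a≡k = FinP.toℕ-fromℕ< k<r
      σ[a≔_] : Fin K → Fin r → Fin K
      σ[a≔ l ] = updateAt σ a (λ _ → l)
      expand : det (mixed (suc k) σ) ≡ sumℤ (λ l → W a l ℤ.* det (setRow a (B l) (mixed (suc k) σ)))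
      expand = det-∑-row K (mixed (suc k) σ) a B (W a) (λ j → mixed-< σ a j (ℕP.≤-reflexive (cong suc a≡k)))
      replaced : ∀ l i j → setRow a (B l) (mixed (suc k) σ) i j ≡ mixed k σ[a≔ l ] i j
      replaced l i j with i ≟ a
      ... | yes refl = trans (setRow-at a (B l) (mixed (suc k) σ) j)
                             (sym (trans (mixed-≮ σ[a≔ l ] a j (ℕP.<-irrefl a≡k)) (cong (λ l' → B l' j) (updateAt-updates a σ))))
      ... | no i≢a with toℕ i ℕP.<? k
      ...   | yes i<k = trans (setRow-off a (B l) (mixed (suc k) σ) i j i≢a)
                              (trans (mixed-< σ i j (ℕP.m<n⇒m<1+n i<k)) (sym (mixed-< σ[a≔ l ] i j i<k)))
      ...   | no i≮k = trans (setRow-off a (B l) (mixed (suc k) σ) i j i≢a) (trans (mixed-≮ σ i j i≮k+1)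
                             (sym (trans (mixed-≮ σ[a≔ l ] i j i≮k) (cong (λ l' → B l' j) (updateAt-minimal i a σ i≢a)))))
        where
        i≮k+1 : ¬ toℕ i ℕ.< suc k
        i≮k+1 i<k+1 = i≢a (FinP.toℕ-injective (trans (ℕP.≤-antisym (ℕP.≤-pred i<k+1) (ℕP.≮⇒≥ i≮k)) (sym a≡k)))

  ∣-det-*ˡ′ : (Fin r → Fin K) → d ∣ℤ det (W *ℤ B)
  ∣-det-*ˡ′ σ = subst (d ∣ℤ_) (det-cong (λ i j → mixed-< σ i j (FinP.toℕ<n i))) (d∣mixed r ℕP.≤-refl σ)

∣-det-*ˡ : ∀ {r K} (W : Mat ℤ r K) (B : Mat ℤ K r) {d : ℤ} →
  (∀ (σ : Fin r → Fin K) → d ∣ℤ det (λ i j → B (σ i) j)) → d ∣ℤ det (W *ℤ B)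
∣-det-*ˡ {zero} W B d∣B = ∣-det-*ˡ′ W B d∣B (λ ())
∣-det-*ˡ {suc r} {zero} W B {d} d∣B = subst (d ∣ℤ_) (sym (det-zero-row (W *ℤ B) fz (λ j → refl))) ∣ℤ0
∣-det-*ˡ {suc r} {suc K} W B d∣B = ∣-det-*ˡ′ W B d∣B (λ _ → fz)

minors-∣-*ʳ : ∀ {m n n' r} (A : Mat ℤ m n) (V : Mat ℤ n n') {d : ℤ} →
  (∀ (s : Fin r → Fin m) (t : Fin r → Fin n) → d ∣ℤ minor A s t) →
  ∀ (s : Fin r → Fin m) (t : Fin r → Fin n') → d ∣ℤ minor (A *ℤ V) s t
minors-∣-*ʳ A V d∣A s t = ∣-det-*ʳ (λ i l → A (s i) l) (λ l j → V l (t j)) (d∣A s)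

minors-∣-*ˡ : ∀ {m' m n r} (U : Mat ℤ m' m) (A : Mat ℤ m n) {d : ℤ} →
  (∀ (s : Fin r → Fin m) (t : Fin r → Fin n) → d ∣ℤ minor A s t) →
  ∀ (s : Fin r → Fin m') (t : Fin r → Fin n) → d ∣ℤ minor (U *ℤ A) s t
minors-∣-*ˡ U A d∣A s t = ∣-det-*ˡ (λ i l → U (s i) l) (λ l j → A l (t j)) (λ σ → d∣A σ t)

∣-det-col : ∀ {n} (M : Mat ℤ n n) (b : Fin n) {d : ℤ} → (∀ i → d ∣ℤ M i b) → d ∣ℤ det M
∣-det-col M b {d} d∣col = subst (d ∣ℤ_) (sym expand) (ℤ∣.∣m∣n⇒∣m+n (ℤ∣.∣m⇒∣m*n (det M₁) ℤ∣.∣-refl) ∣ℤ0)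
  where
  q : Vecℤ _
  q i = ℤ∣._∣_.quotient (d∣col i)
  M₁ = setCol b q M
  expand : det M ≡ d ℤ.* det M₁ ℤ.+ + 0 ℤ.* det M
  expand = det-linear-col M M₁ M b d (+ 0) (λ i j j≢b → sym (setCol-off b q M i j j≢b)) (λ _ _ _ → refl)
    (λ i → trans (ℤ∣._∣_.equality (d∣col i))
                 (trans (ℤP.*-comm (q i) d) (trans (cong (d ℤ.*_) (sym (setCol-at b q M i))) (sym (ℤP.+-identityʳ _)))))

∏ : ∀ {n} → (Fin n → ℕ) → ℕ
∏ {zero} f = 1
∏ {suc n} f = f fz ℕ.* ∏ (f ∘ fs)

det-diagonal : ∀ {n} (M : Mat ℤ n n) (δ : Fin n → ℕ) →
  (∀ i j → i ≢ j → M i j ≡ + 0) → (∀ i → M i i ≡ + δ i) → det M ≡ + ∏ δ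
det-diagonal {zero} M δ off diag = refl
det-diagonal {suc n} M δ off diag = begin
  det M                                               ≡⟨ ℤM.∑-single (laplaceTerm M) fz (λ c c≢0 →
                                                           trans (cong (λ a → sign (toℕ c) ℤ.* (a ℤ.* det (laplaceMinor M c))) (off fz c (c≢0 ∘ sym)))
                                                                 (ℤP.*-zeroʳ (sign (toℕ c)))) ⟩
  + 1 ℤ.* (M fz fz ℤ.* det (laplaceMinor M fz))       ≡⟨ ℤP.*-identityˡ _ ⟩
  M fz fz ℤ.* det (laplaceMinor M fz)                 ≡⟨ cong₂ ℤ._*_ (diag fz)
                                                           (det-diagonal (laplaceMinor M fz) (δ ∘ fs)
                                                             (λ i j i≢j → off (fs i) (fs j) (i≢j ∘ FinP.suc-injective)) (diag ∘ fs)) ⟩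
  + δ fz ℤ.* + ∏ (δ ∘ fs)                             ≡⟨ ℤP.pos-* (δ fz) (∏ (δ ∘ fs)) ⟨
  + ∏ δ                                               ∎
  where open ≡-Reasoning

-- Unimodular equivalence

Mat-setoid : Set → ℕ → ℕ → Setoid 0ℓ 0ℓ
Mat-setoid A m n = record
  { Carrier = Mat A m n
  ; _≈_ = _≈M_
  ; isEquivalence = record { refl = ≈M-refl ; sym = ≈M-sym ; trans = ≈M-trans }
  }

idℤ-diag : ∀ {n} (i : Fin n) → idℤ i i ≡ + 1
idℤ-diag i with toℕ i ℕ.≟ toℕ i
... | yes _ = refl
... | no i≢i = ⊥-elim (i≢i refl)

idℤ-off : ∀ {n} (i j : Fin n) → i ≢ j → idℤ i j ≡ + 0
idℤ-off i j i≢j with toℕ i ℕ.≟ toℕ j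
... | yes i≡j = ⊥-elim (i≢j (FinP.toℕ-injective i≡j))
... | no _ = refl

idℤ-isIdentity : ∀ {n} → ℤM.IsIdentity (idℤ {n})
idℤ-isIdentity = idℤ-diag , idℤ-off

idℤ-sym : ∀ {n} (i j : Fin n) → idℤ i j ≡ idℤ j i
idℤ-sym i j with i ≟ j
... | yes refl = refl
... | no i≢j = trans (idℤ-off i j i≢j) (sym (idℤ-off j i (i≢j ∘ sym)))

idℤ-suc : ∀ {n} (i j : Fin n) → idℤ (fs i) (fs j) ≡ idℤ i j
idℤ-suc i j with i ≟ j
... | yes refl = trans (idℤ-diag (fs i)) (sym (idℤ-diag i))
... | no i≢j = trans (idℤ-off (fs i) (fs j) (i≢j ∘ FinP.suc-injective)) (sym (idℤ-off i j i≢j))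

*ℤ-identityˡ : ∀ {m n} (A : Mat ℤ m n) → (idℤ *ℤ A) ≈M A
*ℤ-identityˡ = ℤM.⊗-identityˡ idℤ-isIdentity

*ℤ-identityʳ : ∀ {m n} (A : Mat ℤ m n) → (A *ℤ idℤ) ≈M A
*ℤ-identityʳ = ℤM.⊗-identityʳ idℤ-isIdentity

unimodular-idℤ : ∀ {n} → Unimodular (idℤ {n})
unimodular-idℤ = idℤ , *ℤ-identityˡ idℤ , *ℤ-identityˡ idℤ

unimodular-* : ∀ {n} {U₁ U₂ : Mat ℤ n n} → Unimodular U₁ → Unimodular U₂ → Unimodular (U₁ *ℤ U₂)
unimodular-* {n} {U₁} {U₂} (U₁' , U₁U₁' , U₁'U₁) (U₂' , U₂U₂' , U₂'U₂) = U₂' *ℤ U₁' , inverseʳ , inverseˡ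
  where
  open SetoidReasoning (Mat-setoid ℤ n n)
  inverseʳ : ((U₁ *ℤ U₂) *ℤ (U₂' *ℤ U₁')) ≈M idℤ
  inverseʳ = begin
    (U₁ *ℤ U₂) *ℤ (U₂' *ℤ U₁')   ≈⟨ ℤM.⊗-assoc U₁ U₂ _ ⟩
    U₁ *ℤ (U₂ *ℤ (U₂' *ℤ U₁'))   ≈⟨ ℤM.⊗-congʳ U₁ (ℤM.⊗-assoc U₂ U₂' U₁') ⟨
    U₁ *ℤ ((U₂ *ℤ U₂') *ℤ U₁')   ≈⟨ ℤM.⊗-congʳ U₁ (ℤM.⊗-congˡ U₁' U₂U₂') ⟩
    U₁ *ℤ (idℤ *ℤ U₁')           ≈⟨ ℤM.⊗-congʳ U₁ (*ℤ-identityˡ U₁') ⟩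
    U₁ *ℤ U₁'                    ≈⟨ U₁U₁' ⟩
    idℤ                          ∎
  inverseˡ : ((U₂' *ℤ U₁') *ℤ (U₁ *ℤ U₂)) ≈M idℤ
  inverseˡ = begin
    (U₂' *ℤ U₁') *ℤ (U₁ *ℤ U₂)   ≈⟨ ℤM.⊗-assoc U₂' U₁' _ ⟩
    U₂' *ℤ (U₁' *ℤ (U₁ *ℤ U₂))   ≈⟨ ℤM.⊗-congʳ U₂' (ℤM.⊗-assoc U₁' U₁ U₂) ⟨
    U₂' *ℤ ((U₁' *ℤ U₁) *ℤ U₂)   ≈⟨ ℤM.⊗-congʳ U₂' (ℤM.⊗-congˡ U₂ U₁'U₁) ⟩
    U₂' *ℤ (idℤ *ℤ U₂)           ≈⟨ ℤM.⊗-congʳ U₂' (*ℤ-identityˡ U₂) ⟩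
    U₂' *ℤ U₂                    ≈⟨ U₂'U₂ ⟩
    idℤ                          ∎

unimodular-transpose : ∀ {n} {U : Mat ℤ n n} → Unimodular U → Unimodular (transpose U)
unimodular-transpose {U = U} (U' , UU' , U'U) =
  transpose U' ,
  (λ i j → trans (sym (ℤM.⊗-transpose U' U i j)) (trans (U'U j i) (idℤ-sym j i))) ,
  (λ i j → trans (sym (ℤM.⊗-transpose U U' i j)) (trans (UU' j i) (idℤ-sym j i)))

record _∼_ {m n} (A B : Mat ℤ m n) : Set where
  field
    U : Mat ℤ m m
    V : Mat ℤ n n
    U-unimodular : Unimodular U
    V-unimodular : Unimodular V
    UAV≈B : ((U *ℤ A) *ℤ V) ≈M B

  U⁻¹ : Mat ℤ m m
  U⁻¹ = proj₁ U-unimodular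

  V⁻¹ : Mat ℤ n n
  V⁻¹ = proj₁ V-unimodular

≈M⇒∼ : ∀ {m n} {A B : Mat ℤ m n} → A ≈M B → A ∼ B
≈M⇒∼ {A = A} A≈B = record
  { U = idℤ ; V = idℤ ; U-unimodular = unimodular-idℤ ; V-unimodular = unimodular-idℤ
  ; UAV≈B = ≈M-trans (*ℤ-identityʳ _) (≈M-trans (*ℤ-identityˡ A) A≈B) }

∼-trans : ∀ {m n} {A B C : Mat ℤ m n} → A ∼ B → B ∼ C → A ∼ C
∼-trans {m} {n} {A} {B} {C} A∼B B∼C = record
  { U = U₂ *ℤ U₁ ; V = V₁ *ℤ V₂
  ; U-unimodular = unimodular-* (B∼C .U-unimodular) (A∼B .U-unimodular)
  ; V-unimodular = unimodular-* (A∼B .V-unimodular) (B∼C .V-unimodular)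
  ; UAV≈B = begin
      ((U₂ *ℤ U₁) *ℤ A) *ℤ (V₁ *ℤ V₂)   ≈⟨ ℤM.⊗-congˡ (V₁ *ℤ V₂) (ℤM.⊗-assoc U₂ U₁ A) ⟩
      (U₂ *ℤ (U₁ *ℤ A)) *ℤ (V₁ *ℤ V₂)   ≈⟨ ℤM.⊗-assoc (U₂ *ℤ (U₁ *ℤ A)) V₁ V₂ ⟨
      ((U₂ *ℤ (U₁ *ℤ A)) *ℤ V₁) *ℤ V₂   ≈⟨ ℤM.⊗-congˡ V₂ (ℤM.⊗-assoc U₂ (U₁ *ℤ A) V₁) ⟩
      (U₂ *ℤ ((U₁ *ℤ A) *ℤ V₁)) *ℤ V₂   ≈⟨ ℤM.⊗-congˡ V₂ (ℤM.⊗-congʳ U₂ (A∼B .UAV≈B)) ⟩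
      (U₂ *ℤ B) *ℤ V₂                   ≈⟨ B∼C .UAV≈B ⟩
      C                                 ∎ }
  where
  open _∼_
  open SetoidReasoning (Mat-setoid ℤ m n)
  U₁ = A∼B .U
  V₁ = A∼B .V
  U₂ = B∼C .U
  V₂ = B∼C .V

∼-sym : ∀ {m n} {A B : Mat ℤ m n} → A ∼ B → B ∼ A
∼-sym {m} {n} {A} {B} record { U = U ; V = V ; U-unimodular = (U' , UU' , U'U) ; V-unimodular = (V' , VV' , V'V) ; UAV≈B = UAV≈B } =
  record
  { U = U' ; V = V' ; U-unimodular = U , U'U , UU' ; V-unimodular = V , V'V , VV'
  ; UAV≈B = begin
      (U' *ℤ B) *ℤ V'                    ≈⟨ ℤM.⊗-congˡ V' (ℤM.⊗-congʳ U' UAV≈B) ⟨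
      (U' *ℤ ((U *ℤ A) *ℤ V)) *ℤ V'      ≈⟨ ℤM.⊗-congˡ V' (ℤM.⊗-assoc U' (U *ℤ A) V) ⟨
      ((U' *ℤ (U *ℤ A)) *ℤ V) *ℤ V'      ≈⟨ ℤM.⊗-congˡ V' (ℤM.⊗-congˡ V (ℤM.⊗-assoc U' U A)) ⟨
      (((U' *ℤ U) *ℤ A) *ℤ V) *ℤ V'      ≈⟨ ℤM.⊗-congˡ V' (ℤM.⊗-congˡ V (ℤM.⊗-congˡ A U'U)) ⟩
      ((idℤ *ℤ A) *ℤ V) *ℤ V'            ≈⟨ ℤM.⊗-congˡ V' (ℤM.⊗-congˡ V (*ℤ-identityˡ A)) ⟩
      (A *ℤ V) *ℤ V'                     ≈⟨ ℤM.⊗-assoc A V V' ⟩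
      A *ℤ (V *ℤ V')                     ≈⟨ ℤM.⊗-congʳ A VV' ⟩
      A *ℤ idℤ                           ≈⟨ *ℤ-identityʳ A ⟩
      A                                  ∎ }
  where open SetoidReasoning (Mat-setoid ℤ m n)

∼-transpose : ∀ {m n} {A B : Mat ℤ m n} → A ∼ B → transpose A ∼ transpose B
∼-transpose {m} {n} {A} {B} A∼B = record
  { U = transpose V ; V = transpose U
  ; U-unimodular = unimodular-transpose V-unimodular ; V-unimodular = unimodular-transpose U-unimodular
  ; UAV≈B = begin
      (transpose V *ℤ transpose A) *ℤ transpose U  ≈⟨ ℤM.⊗-congˡ (transpose U) (ℤM.⊗-transpose A V) ⟨
      transpose (A *ℤ V) *ℤ transpose U            ≈⟨ ℤM.⊗-transpose U (A *ℤ V) ⟨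
      transpose (U *ℤ (A *ℤ V))                    ≈⟨ (λ i j → ℤM.⊗-assoc U A V j i) ⟨
      transpose ((U *ℤ A) *ℤ V)                    ≈⟨ (λ i j → UAV≈B j i) ⟩
      transpose B                                  ∎ }
  where
  open _∼_ A∼B
  open SetoidReasoning (Mat-setoid ℤ n m)

∼-left : ∀ {m n} {A B : Mat ℤ m n} (E : Mat ℤ m m) → Unimodular E → (E *ℤ A) ≈M B → A ∼ B
∼-left E E-unimodular EA≈B = record
  { U = E ; V = idℤ ; U-unimodular = E-unimodular ; V-unimodular = unimodular-idℤ
  ; UAV≈B = ≈M-trans (*ℤ-identityʳ _) EA≈B }

∼-swap-rows : ∀ {m n} (a b : Fin m) (A : Mat ℤ m n) → A ∼ (λ i j → A (swap a b i) j)
∼-swap-rows a b A = ∼-left (P a b) (P b a , P-inverse a b , P-inverse b a) (λ i → *ℤ-identityˡ A (swap a b i))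
  where
  P : ∀ {m} → Fin m → Fin m → Mat ℤ m m
  P a b i = idℤ (swap a b i)
  P-inverse : ∀ a b → (P a b *ℤ P b a) ≈M idℤ
  P-inverse a b i j = trans (*ℤ-identityˡ (P b a) (swap a b i) j) (cong (λ k → idℤ k j) (swap-inverse b a))

∼-swap-cols : ∀ {m n} (a b : Fin n) (A : Mat ℤ m n) → A ∼ (λ i j → A i (swap a b j))
∼-swap-cols a b A = ∼-transpose (∼-swap-rows a b (transpose A))

∼-swap-to-corner : ∀ {m n} (A : Mat ℤ (suc m) (suc n)) i j → A ∼ (λ r c → A (swap fz i r) (swap fz j c))
∼-swap-to-corner A i j = ∼-trans (∼-swap-rows fz i A) (∼-swap-cols fz j (λ r c → A (swap fz i r) c))

-- The hypothesis c b ≡ 0 makes the operation with -c its inverse.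
∼-add-row-multiples : ∀ {m n} (b : Fin m) (c : Vecℤ m) → c b ≡ + 0 →
  (A : Mat ℤ m n) → A ∼ (λ i j → A i j ℤ.+ c i ℤ.* A b j)
∼-add-row-multiples {m} b c c-b≡0 A = ∼-left (E c)
  (E (ℤ.-_ ∘ c) , E-inverse c (ℤ.-_ ∘ c) c-b≡0 (λ _ → refl) ,
                  E-inverse (ℤ.-_ ∘ c) c (cong ℤ.-_ c-b≡0) (λ i → sym (ℤP.neg-involutive (c i))))
  (E-action c A)
  where
  E : Vecℤ m → Mat ℤ m m
  E c i t = idℤ i t ℤ.+ c i ℤ.* idℤ b t
  E-action : ∀ {n} c (M : Mat ℤ m n) → (E c *ℤ M) ≈M (λ i j → M i j ℤ.+ c i ℤ.* M b j)
  E-action c M i j = begin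
    sumℤ (λ t → (idℤ i t ℤ.+ c i ℤ.* idℤ b t) ℤ.* M t j)
      ≡⟨ ℤM.∑-cong (λ t → trans (ℤP.*-distribʳ-+ (M t j) (idℤ i t) _)
                                (cong (λ z → idℤ i t ℤ.* M t j ℤ.+ z) (ℤP.*-assoc (c i) (idℤ b t) (M t j)))) ⟩
    sumℤ (λ t → idℤ i t ℤ.* M t j ℤ.+ c i ℤ.* (idℤ b t ℤ.* M t j))
      ≡⟨ ℤM.∑-+ (λ t → idℤ i t ℤ.* M t j) (λ t → c i ℤ.* (idℤ b t ℤ.* M t j)) ⟩
    (idℤ *ℤ M) i j ℤ.+ sumℤ (λ t → c i ℤ.* (idℤ b t ℤ.* M t j))
      ≡⟨ cong₂ ℤ._+_ (*ℤ-identityˡ M i j)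
                     (trans (sym (ℤM.*-distribˡ-∑ (c i) (λ t → idℤ b t ℤ.* M t j))) (cong (c i ℤ.*_) (*ℤ-identityˡ M b j))) ⟩
    M i j ℤ.+ c i ℤ.* M b j ∎
    where open ≡-Reasoning
  E-inverse : ∀ c c' → c b ≡ + 0 → (∀ i → c' i ≡ ℤ.- c i) → (E c *ℤ E c') ≈M idℤ
  E-inverse c c' c-b≡0 c'≡-c i j = begin
    (E c *ℤ E c') i j                                                 ≡⟨ E-action c (E c') i j ⟩
    (idℤ i j ℤ.+ c' i ℤ.* idℤ b j) ℤ.+ c i ℤ.* (idℤ b j ℤ.+ c' b ℤ.* idℤ b j)
      ≡⟨ cong₂ (λ x y → (idℤ i j ℤ.+ x ℤ.* idℤ b j) ℤ.+ c i ℤ.* (idℤ b j ℤ.+ y ℤ.* idℤ b j))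
               (c'≡-c i) (trans (c'≡-c b) (cong ℤ.-_ c-b≡0)) ⟩
    (idℤ i j ℤ.+ ℤ.- c i ℤ.* idℤ b j) ℤ.+ c i ℤ.* (idℤ b j ℤ.+ ℤ.- + 0 ℤ.* idℤ b j) ≡⟨ cancel (idℤ i j) (c i) (idℤ b j) ⟩
    idℤ i j                                                           ∎
    where
    open ≡-Reasoning
    cancel : ∀ x y z → (x ℤ.+ ℤ.- y ℤ.* z) ℤ.+ y ℤ.* (z ℤ.+ ℤ.- + 0 ℤ.* z) ≡ x
    cancel = solve-∀

∼-scale-rows : ∀ {m n} (s : Vecℤ m) → (∀ i → s i ℤ.* s i ≡ + 1) → (A : Mat ℤ m n) → A ∼ (λ i j → s i ℤ.* A i j)
∼-scale-rows {m} s s²≡1 A = ∼-left S (S , S-involutive , S-involutive) (S-action A)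
  where
  S : Mat ℤ m m
  S i t = s i ℤ.* idℤ i t
  S-action : ∀ {n} (M : Mat ℤ m n) → (S *ℤ M) ≈M (λ i j → s i ℤ.* M i j)
  S-action M i j = trans (ℤM.∑-cong (λ t → ℤP.*-assoc (s i) (idℤ i t) (M t j)))
                         (trans (sym (ℤM.*-distribˡ-∑ (s i) (λ t → idℤ i t ℤ.* M t j))) (cong (s i ℤ.*_) (*ℤ-identityˡ M i j)))
  S-involutive : (S *ℤ S) ≈M idℤ
  S-involutive i j = trans (S-action S i j)
    (trans (sym (ℤP.*-assoc (s i) (s i) (idℤ i j))) (trans (cong (ℤ._* idℤ i j) (s²≡1 i)) (ℤP.*-identityˡ _)))

-- Smith normal form

division-step : ∀ (x a : ℤ) → a ≢ + 0 →
  Σ ℤ λ q → ℤ.∣ x ℤ.+ q ℤ.* a ∣ ℕ.< ℤ.∣ a ∣ × (x ℤ.+ q ℤ.* a ≡ + 0 → a ∣ℤ x)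
division-step x a a≢0 = ℤ.- (x ℤ./ a) , remainder-small , remainder-zero
  where
  instance _ = ℤ.≢-nonZero a≢0
  remainder : x ℤ.+ ℤ.- (x ℤ./ a) ℤ.* a ≡ + (x ℤ.% a)
  remainder = trans (cong (λ z → z ℤ.+ ℤ.- (x ℤ./ a) ℤ.* a) (ℤDivMod.a≡a%n+[a/n]*n x a))
                    (cancel (+ (x ℤ.% a)) (x ℤ./ a) a)
    where
    cancel : ∀ r q a → r ℤ.+ q ℤ.* a ℤ.+ ℤ.- q ℤ.* a ≡ r
    cancel = solve-∀
  remainder-small : ℤ.∣ x ℤ.+ ℤ.- (x ℤ./ a) ℤ.* a ∣ ℕ.< ℤ.∣ a ∣
  remainder-small = subst (λ z → ℤ.∣ z ∣ ℕ.< ℤ.∣ a ∣) (sym remainder) (ℤDivMod.n%d<d x a)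
  remainder-zero : x ℤ.+ ℤ.- (x ℤ./ a) ℤ.* a ≡ + 0 → a ∣ℤ x
  remainder-zero r≡0 = ℤ∣.divides (x ℤ./ a) (trans (ℤDivMod.a≡a%n+[a/n]*n x a)
    (trans (cong (λ z → z ℤ.+ (x ℤ./ a) ℤ.* a) (trans (sym remainder) r≡0)) (ℤP.+-identityˡ _)))

record ColumnReduced {m n} (A : Mat ℤ (suc m) (suc n)) : Set where
  field
    reduced : Mat ℤ (suc m) (suc n)
    equivalent : A ∼ reduced
    pivot-row : ∀ j → reduced fz j ≡ A fz j
    below-small : ∀ i → ℤ.∣ reduced (fs i) fz ∣ ℕ.< ℤ.∣ A fz fz ∣
    below-zero⇒∣ : ∀ i → reduced (fs i) fz ≡ + 0 → A fz fz ∣ℤ A (fs i) fz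

reduce-column : ∀ {m n} (A : Mat ℤ (suc m) (suc n)) → A fz fz ≢ + 0 → ColumnReduced A
reduce-column {m} A a≢0 = record
  { reduced = λ i j → A i j ℤ.+ c i ℤ.* A fz j
  ; equivalent = ∼-add-row-multiples fz c refl A
  ; pivot-row = λ j → ℤP.+-identityʳ (A fz j)
  ; below-small = λ i → proj₁ (proj₂ (step i))
  ; below-zero⇒∣ = λ i → proj₂ (proj₂ (step i))
  }
  where
  step : ∀ i → Σ ℤ λ q → ℤ.∣ A (fs i) fz ℤ.+ q ℤ.* A fz fz ∣ ℕ.< ℤ.∣ A fz fz ∣ ×
                          (A (fs i) fz ℤ.+ q ℤ.* A fz fz ≡ + 0 → A fz fz ∣ℤ A (fs i) fz)
  step i = division-step (A (fs i) fz) (A fz fz) a≢0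
  c : Vecℤ (suc m)
  c fz = + 0
  c (fs i) = proj₁ (step i)

record RowReduced {m n} (A : Mat ℤ (suc m) (suc n)) : Set where
  field
    reduced : Mat ℤ (suc m) (suc n)
    equivalent : A ∼ reduced
    pivot-col : ∀ i → reduced i fz ≡ A i fz
    right-small : ∀ j → ℤ.∣ reduced fz (fs j) ∣ ℕ.< ℤ.∣ A fz fz ∣
    right-zero⇒∣ : ∀ j → reduced fz (fs j) ≡ + 0 → A fz fz ∣ℤ A fz (fs j)

reduce-row : ∀ {m n} (A : Mat ℤ (suc m) (suc n)) → A fz fz ≢ + 0 → RowReduced A
reduce-row A a≢0 = record
  { reduced = transpose reduced
  ; equivalent = ∼-transpose equivalent
  ; pivot-col = pivot-row
  ; right-small = below-small
  ; right-zero⇒∣ = below-zero⇒∣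
  }
  where open ColumnReduced (reduce-column (transpose A) a≢0)

record PivotForm {m n} (B : Mat ℤ (suc m) (suc n)) : Set where
  field
    pivot-nonzero : B fz fz ≢ + 0
    column-zero : ∀ i → B (fs i) fz ≡ + 0
    row-zero : ∀ j → B fz (fs j) ≡ + 0
    pivot-divides : ∀ i j → B fz fz ∣ℤ B i j

record Improvement {m n} (A : Mat ℤ (suc m) (suc n)) : Set where
  field
    improved : Mat ℤ (suc m) (suc n)
    equivalent : A ∼ improved
    pivot-nonzero : improved fz fz ≢ + 0
    pivot-smaller : ℤ.∣ improved fz fz ∣ ℕ.< ℤ.∣ A fz fz ∣

improvement-at : ∀ {m n} {A A' : Mat ℤ (suc m) (suc n)} → A ∼ A' →
  ∀ i j → A' i j ≢ + 0 → ℤ.∣ A' i j ∣ ℕ.< ℤ.∣ A fz fz ∣ → Improvement A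
improvement-at {A' = A'} A∼A' i j nonzero smaller = record
  { improved = λ r c → A' (swap fz i r) (swap fz j c)
  ; equivalent = ∼-trans A∼A' (∼-swap-to-corner A' i j)
  ; pivot-nonzero = λ corner≡0 → nonzero (trans (sym corner) corner≡0)
  ; pivot-smaller = subst (λ z → ℤ.∣ z ∣ ℕ.< _) (sym corner) smaller
  }
  where
  corner : A' (swap fz i fz) (swap fz j fz) ≡ A' i j
  corner = cong₂ A' (swap-matchˡ fz i) (swap-matchˡ fz j)

-- Adding row i to the pivot row puts the entry the pivot does not divide into the pivot row,
-- where row reduction leaves a nonzero remainder.
improvement-from-nondivisible : ∀ {m n} (A : Mat ℤ (suc m) (suc n)) → A fz fz ≢ + 0 →
  (∀ i → A (fs i) fz ≡ + 0) → (∀ j → A fz (fs j) ≡ + 0) →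
  ∀ i j → ¬ A fz fz ∣ℤ A (fs i) (fs j) → Improvement A
improvement-from-nondivisible {m} A a≢0 col-zero row-zero i j a∤Aij =
  improvement-at (∼-trans (∼-add-row-multiples (fs i) c refl A) equivalent) fz (fs j) nonzero small
  where
  c : Vecℤ (suc m)
  c fz = + 1
  c (fs _) = + 0
  A' = λ r c' → A r c' ℤ.+ c r ℤ.* A (fs i) c'
  pivot : A' fz fz ≡ A fz fz
  pivot = trans (cong (λ z → A fz fz ℤ.+ + 1 ℤ.* z) (col-zero i)) (ℤP.+-identityʳ (A fz fz))
  entry : A' fz (fs j) ≡ A (fs i) (fs j)
  entry = trans (cong (λ z → z ℤ.+ + 1 ℤ.* A (fs i) (fs j)) (row-zero j))
                (trans (ℤP.+-identityˡ _) (ℤP.*-identityˡ _))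
  open RowReduced (reduce-row A' (a≢0 ∘ trans (sym pivot)))
  nonzero : reduced fz (fs j) ≢ + 0
  nonzero r≡0 = a∤Aij (subst₂ _∣ℤ_ pivot entry (right-zero⇒∣ j r≡0))
  small : ℤ.∣ reduced fz (fs j) ∣ ℕ.< ℤ.∣ A fz fz ∣
  small = subst (λ z → ℤ.∣ reduced fz (fs j) ∣ ℕ.< ℤ.∣ z ∣) pivot (right-small j)

improvement-∼ : ∀ {m n} {A R : Mat ℤ (suc m) (suc n)} → A ∼ R → R fz fz ≡ A fz fz → Improvement R → Improvement A
improvement-∼ A∼R same-pivot better = record
  { improved = improved
  ; equivalent = ∼-trans A∼R equivalent
  ; pivot-nonzero = pivot-nonzero
  ; pivot-smaller = subst (λ z → ℤ.∣ improved fz fz ∣ ℕ.< ℤ.∣ z ∣) same-pivot pivot-smaller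
  }
  where open Improvement better

PivotReduct : ∀ {m n} → Mat ℤ (suc m) (suc n) → Set
PivotReduct {m} {n} A = Σ (Mat ℤ (suc m) (suc n)) λ B → A ∼ B × PivotForm B

-- Reduce the first column, then the first row, modulo the pivot; a nonzero remainder, or an
-- entry the pivot does not divide, yields a smaller pivot.
pivot-step : ∀ {m n} (A : Mat ℤ (suc m) (suc n)) → A fz fz ≢ + 0 → PivotReduct A ⊎ Improvement A
pivot-step {m} {n} A a≢0 = after-column (all? (λ i → C (fs i) fz ℤ.≟ + 0))
  where
  open ColumnReduced (reduce-column A a≢0) renaming (reduced to C; equivalent to A∼C)
  C-pivot : C fz fz ≡ A fz fz
  C-pivot = pivot-row fz
  open RowReduced (reduce-row C (a≢0 ∘ trans (sym C-pivot))) renaming (reduced to R; equivalent to C∼R)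
  A∼R : A ∼ R
  A∼R = ∼-trans A∼C C∼R
  R-pivot : R fz fz ≡ A fz fz
  R-pivot = trans (pivot-col fz) C-pivot
  R-pivot-nonzero : R fz fz ≢ + 0
  R-pivot-nonzero = a≢0 ∘ trans (sym R-pivot)

  module _ (col-clear : ∀ i → C (fs i) fz ≡ + 0) (row-clear : ∀ j → R fz (fs j) ≡ + 0) where

    R-col-clear : ∀ i → R (fs i) fz ≡ + 0
    R-col-clear i = trans (pivot-col (fs i)) (col-clear i)

    after-divisibility : Dec (∀ i j → R fz fz ∣ℤ R (fs i) (fs j)) → PivotReduct A ⊎ Improvement A
    after-divisibility (yes divisible) = inj₁ (R , A∼R , record
      { pivot-nonzero = R-pivot-nonzero ; column-zero = R-col-clear ; row-zero = row-clear
      ; pivot-divides = pivot-divides })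
      where
      pivot-divides : ∀ i j → R fz fz ∣ℤ R i j
      pivot-divides fz fz = ℤ∣.∣-refl
      pivot-divides fz (fs j) = subst (R fz fz ∣ℤ_) (sym (row-clear j)) ∣ℤ0
      pivot-divides (fs i) fz = subst (R fz fz ∣ℤ_) (sym (R-col-clear i)) ∣ℤ0
      pivot-divides (fs i) (fs j) = divisible i j
    after-divisibility (no ¬divisible) =
      let (i , ¬row-divisible) = ¬∀⟶∃¬ m _ (λ i → all? (λ j → R fz fz ℤ∣.∣? R (fs i) (fs j))) ¬divisible
          (j , nondivisible) = ¬∀⟶∃¬ n _ (λ j → R fz fz ℤ∣.∣? R (fs i) (fs j)) ¬row-divisible
      in inj₂ (improvement-∼ A∼R R-pivot
                 (improvement-from-nondivisible R R-pivot-nonzero R-col-clear row-clear i j nondivisible))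

  after-row : (∀ i → C (fs i) fz ≡ + 0) → Dec (∀ j → R fz (fs j) ≡ + 0) → PivotReduct A ⊎ Improvement A
  after-row col-clear (yes row-clear) =
    after-divisibility col-clear row-clear (all? (λ i → all? (λ j → R fz fz ℤ∣.∣? R (fs i) (fs j))))
  after-row col-clear (no ¬row-clear) =
    let (j , nonzero) = ¬∀⟶∃¬ n _ (λ j → R fz (fs j) ℤ.≟ + 0) ¬row-clear in
    inj₂ (improvement-at A∼R fz (fs j) nonzero (subst (λ z → ℤ.∣ R fz (fs j) ∣ ℕ.< ℤ.∣ z ∣) C-pivot (right-small j)))

  after-column : Dec (∀ i → C (fs i) fz ≡ + 0) → PivotReduct A ⊎ Improvement A
  after-column (yes col-clear) = after-row col-clear (all? (λ j → R fz (fs j) ℤ.≟ + 0))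
  after-column (no ¬col-clear) =
    let (i , nonzero) = ¬∀⟶∃¬ m _ (λ i → C (fs i) fz ℤ.≟ + 0) ¬col-clear in
    inj₂ (improvement-at A∼C (fs i) fz nonzero (below-small i))

pivot-form : ∀ {m n} k (A : Mat ℤ (suc m) (suc n)) → ℤ.∣ A fz fz ∣ ℕ.< k → A fz fz ≢ + 0 → PivotReduct A
pivot-form (suc k) A |a|<1+k a≢0 with pivot-step A a≢0
... | inj₁ reduct = reduct
... | inj₂ better =
  let (B , A'∼B , B-pivot) = pivot-form k improved (ℕP.<-≤-trans pivot-smaller (ℕP.≤-pred |a|<1+k)) pivot-nonzero
  in B , ∼-trans equivalent A'∼B , B-pivot
  where open Improvement better

sumℤ-zeros : ∀ {n} → sumℤ {n} (λ _ → + 0) ≡ + 0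
sumℤ-zeros {n} = ℤM.∑-zero {n} (λ _ → + 0) (λ _ → refl)

block : ∀ {m n} → ℤ → Mat ℤ m n → Mat ℤ (suc m) (suc n)
block x M fz fz = x
block x M fz (fs j) = + 0
block x M (fs i) fz = + 0
block x M (fs i) (fs j) = M i j

block-*ˡ : ∀ {m m' n} (U : Mat ℤ m' m) x (M : Mat ℤ m n) → (block (+ 1) U *ℤ block x M) ≈M block x (U *ℤ M)
block-*ˡ {m} U x M fz fz = trans (cong₂ ℤ._+_ (ℤP.*-identityˡ x) (sumℤ-zeros {m})) (ℤP.+-identityʳ x)
block-*ˡ {m} U x M fz (fs j) = cong (λ z → + 0 ℤ.+ z) (sumℤ-zeros {m})
block-*ˡ U x M (fs i) fz = cong (λ z → + 0 ℤ.+ z) (ℤM.∑-zero (λ t → U i t ℤ.* + 0) (λ t → ℤP.*-zeroʳ (U i t)))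
block-*ˡ U x M (fs i) (fs j) = ℤP.+-identityˡ _

block-*ʳ : ∀ {m n n'} x (M : Mat ℤ m n) (V : Mat ℤ n n') → (block x M *ℤ block (+ 1) V) ≈M block x (M *ℤ V)
block-*ʳ {n = n} x M V fz fz = trans (cong₂ ℤ._+_ (ℤP.*-identityʳ x) (sumℤ-zeros {n})) (ℤP.+-identityʳ x)
block-*ʳ {n = n} x M V fz (fs j) = cong₂ ℤ._+_ (ℤP.*-zeroʳ x) (sumℤ-zeros {n})
block-*ʳ x M V (fs i) fz = cong (λ z → + 0 ℤ.+ z) (ℤM.∑-zero (λ t → M i t ℤ.* + 0) (λ t → ℤP.*-zeroʳ (M i t)))
block-*ʳ x M V (fs i) (fs j) = ℤP.+-identityˡ _

block-cong : ∀ {m n} x {M N : Mat ℤ m n} → M ≈M N → block x M ≈M block x N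
block-cong x M≈N fz fz = refl
block-cong x M≈N fz (fs j) = refl
block-cong x M≈N (fs i) fz = refl
block-cong x M≈N (fs i) (fs j) = M≈N i j

block-idℤ : ∀ {n} → block (+ 1) (idℤ {n}) ≈M idℤ
block-idℤ fz fz = refl
block-idℤ fz (fs j) = refl
block-idℤ (fs i) fz = refl
block-idℤ (fs i) (fs j) = sym (idℤ-suc i j)

unimodular-block : ∀ {n} {U : Mat ℤ n n} → Unimodular U → Unimodular (block (+ 1) U)
unimodular-block {U = U} (U' , UU' , U'U) =
  block (+ 1) U' ,
  ≈M-trans (block-*ˡ U (+ 1) U') (≈M-trans (block-cong (+ 1) UU') block-idℤ) ,
  ≈M-trans (block-*ˡ U' (+ 1) U) (≈M-trans (block-cong (+ 1) U'U) block-idℤ)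

∼-block : ∀ {m n} x {M N : Mat ℤ m n} → M ∼ N → block x M ∼ block x N
∼-block x {M} M∼N = record
  { U = block (+ 1) U ; V = block (+ 1) V
  ; U-unimodular = unimodular-block U-unimodular ; V-unimodular = unimodular-block V-unimodular
  ; UAV≈B = ≈M-trans (ℤM.⊗-congˡ (block (+ 1) V) (block-*ˡ U x M))
              (≈M-trans (block-*ʳ x (U *ℤ M) V) (block-cong x UAV≈B)) }
  where open _∼_ M∼N

∣-entries-∼ : ∀ {m n} {A B : Mat ℤ m n} {d : ℤ} → A ∼ B → (∀ i j → d ∣ℤ A i j) → ∀ i j → d ∣ℤ B i j
∣-entries-∼ {d = d} A∼B d∣A i j = subst (d ∣ℤ_) (UAV≈B i j)
  (∣-∑ _ (λ l → ℤ∣.∣m⇒∣m*n (V l j) (∣-∑ _ (λ t → ℤ∣.∣n⇒∣m*n (U i t) (d∣A t l)))))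
  where open _∼_ A∼B

snf-diag : ∀ {m n r} {D : Mat ℤ m n} {δ : Fin r → ℕ} → IsSNF D δ →
  ∀ k (r≤m : r ℕ.≤ m) (r≤n : r ℕ.≤ n) → D (inject≤ k r≤m) (inject≤ k r≤n) ≡ + δ k
snf-diag (_ , _ , _ , _ , diag) k r≤m r≤n = diag k _ _ (FinP.toℕ-inject≤ k r≤m) (FinP.toℕ-inject≤ k r≤n)

IsSNF-block : ∀ {m n r} (D : Mat ℤ m n) (δ : Fin r → ℕ) (a : ℕ) → IsSNF D δ → 1 ℕ.≤ a → (∀ k → a ∣ δ k) →
  IsSNF (block (+ a) D) (a ∷ δ)
IsSNF-block {r = r} D δ a (δ-pos , δ-chain , off-diag , beyond , diag) a-pos a∣δ =
  positive , chain , off-diag′ , beyond′ , diag′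
  where
  positive : ∀ k → 1 ℕ.≤ (a ∷ δ) k
  positive fz = a-pos
  positive (fs k) = δ-pos k
  chain : ∀ k l → toℕ k ℕ.≤ toℕ l → (a ∷ δ) k ∣ (a ∷ δ) l
  chain fz fz _ = ℕDiv.∣-refl
  chain fz (fs l) _ = a∣δ l
  chain (fs k) (fs l) (s≤s k≤l) = δ-chain k l k≤l
  off-diag′ : ∀ i j → toℕ i ≢ toℕ j → block (+ a) D i j ≡ + 0
  off-diag′ fz fz i≢j = ⊥-elim (i≢j refl)
  off-diag′ fz (fs j) _ = refl
  off-diag′ (fs i) fz _ = refl
  off-diag′ (fs i) (fs j) i≢j = off-diag i j (i≢j ∘ cong suc)
  beyond′ : ∀ i j → toℕ i ≡ toℕ j → suc r ℕ.≤ toℕ i → block (+ a) D i j ≡ + 0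
  beyond′ (fs i) fz _ _ = refl
  beyond′ (fs i) (fs j) i≡j (s≤s r≤i) = beyond i j (ℕP.suc-injective i≡j) r≤i
  diag′ : ∀ (k : Fin (suc r)) i j → toℕ i ≡ toℕ k → toℕ j ≡ toℕ k → block (+ a) D i j ≡ + (a ∷ δ) k
  diag′ fz fz fz _ _ = refl
  diag′ (fs k) (fs i) (fs j) i≡k j≡k = diag k i j (ℕP.suc-injective i≡k) (ℕP.suc-injective j≡k)

sign-normalize : ∀ b → b ≢ + 0 → Σ ℤ λ ε → ε ℤ.* ε ≡ + 1 × ε ℤ.* b ≡ + ℤ.∣ b ∣ × 1 ℕ.≤ ℤ.∣ b ∣
sign-normalize (+ zero) b≢0 = ⊥-elim (b≢0 refl)
sign-normalize (+ suc k) _ = + 1 , refl , ℤP.*-identityˡ _ , s≤s z≤n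
sign-normalize -[1+ k ] _ = ℤ.- + 1 , refl , ℤP.-1*i≡-i -[1+ k ] , s≤s z≤n

record SmithNormalForm {m n} (A : Mat ℤ m n) : Set where
  field
    rank : ℕ
    δ : Fin rank → ℕ
    D : Mat ℤ m n
    A∼D : A ∼ D
    isSNF : IsSNF D δ
    rank≤m : rank ℕ.≤ m
    rank≤n : rank ℕ.≤ n

SmithNormalForm-∼ : ∀ {m n} {A B : Mat ℤ m n} → A ∼ B → SmithNormalForm B → SmithNormalForm A
SmithNormalForm-∼ A∼B snf = record
  { rank = rank ; δ = δ ; D = D ; A∼D = ∼-trans A∼B A∼D ; isSNF = isSNF ; rank≤m = rank≤m ; rank≤n = rank≤n }
  where open SmithNormalForm snf

zero-SmithNormalForm : ∀ {m n} (A : Mat ℤ m n) → (∀ i j → A i j ≡ + 0) → SmithNormalForm A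
zero-SmithNormalForm A A≡0 = record
  { rank = 0 ; δ = λ () ; D = A ; A∼D = ≈M⇒∼ ≈M-refl
  ; isSNF = (λ ()) , (λ ()) , (λ i j _ → A≡0 i j) , (λ i j _ _ → A≡0 i j) , (λ ())
  ; rank≤m = z≤n ; rank≤n = z≤n }

smith-from-pivot : ∀ {m n} (B : Mat ℤ (suc m) (suc n)) → PivotForm B →
  SmithNormalForm (λ r c → B (fs r) (fs c)) → SmithNormalForm B
smith-from-pivot {m} B B-pivot snf = record
  { rank = suc rank ; δ = a ∷ δ ; D = block (+ a) D ; A∼D = B∼block
  ; isSNF = IsSNF-block D δ a isSNF a-pos a∣δ
  ; rank≤m = s≤s rank≤m ; rank≤n = s≤s rank≤n }
  where
  open PivotForm B-pivot
  open SmithNormalForm snf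
  normalized = sign-normalize (B fz fz) pivot-nonzero
  ε = proj₁ normalized
  a = ℤ.∣ B fz fz ∣
  a-pos : 1 ℕ.≤ a
  a-pos = proj₂ (proj₂ (proj₂ normalized))
  s : Vecℤ (suc m)
  s fz = ε
  s (fs _) = + 1
  s²≡1 : ∀ i → s i ℤ.* s i ≡ + 1
  s²≡1 fz = proj₁ (proj₂ normalized)
  s²≡1 (fs _) = refl
  scaled≈block : (λ r c → s r ℤ.* B r c) ≈M block (+ a) (λ r c → B (fs r) (fs c))
  scaled≈block fz fz = proj₁ (proj₂ (proj₂ normalized))
  scaled≈block fz (fs c) = trans (cong (ε ℤ.*_) (row-zero c)) (ℤP.*-zeroʳ ε)
  scaled≈block (fs r) fz = trans (ℤP.*-identityˡ _) (column-zero r)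
  scaled≈block (fs r) (fs c) = ℤP.*-identityˡ _
  B∼block : B ∼ block (+ a) D
  B∼block = ∼-trans (∼-scale-rows s s²≡1 B) (∼-trans (≈M⇒∼ scaled≈block) (∼-block (+ a) A∼D))
  a∣D : ∀ i j → + a ∣ℤ D i j
  a∣D = ∣-entries-∼ A∼D (λ r c → ℤ∣.∣-trans ℤ∣.∣m∣∣m (pivot-divides (fs r) (fs c)))
  a∣δ : ∀ k → a ∣ δ k
  a∣δ k = ℤ∣.∣⇒∣ᵤ (subst (+ a ∣ℤ_) (snf-diag isSNF k rank≤m rank≤n) (a∣D _ _))

smith : ∀ {m n} (A : Mat ℤ m n) → SmithNormalForm A
smith {zero} A = zero-SmithNormalForm A (λ ())
smith {suc m} {zero} A = zero-SmithNormalForm A (λ i ())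
smith {suc m} {suc n} A with all? (λ i → all? (λ j → A i j ℤ.≟ + 0))
... | yes A≡0 = zero-SmithNormalForm A A≡0
... | no A≢0 =
  let (i , row-i≢0) = ¬∀⟶∃¬ (suc m) _ (λ i → all? (λ j → A i j ℤ.≟ + 0)) A≢0
      (j , Aij≢0) = ¬∀⟶∃¬ (suc n) _ (λ j → A i j ℤ.≟ + 0) row-i≢0
      A' = λ r c → A (swap fz i r) (swap fz j c)
      corner = cong₂ A (swap-matchˡ fz i) (swap-matchˡ fz j)
      (B , A'∼B , B-pivot) = pivot-form (suc ℤ.∣ A' fz fz ∣) A' (ℕP.n<1+n _) (Aij≢0 ∘ trans (sym corner))
  in SmithNormalForm-∼ (∼-trans (∼-swap-to-corner A i j) A'∼B)
                       (smith-from-pivot B B-pivot (smith (λ r c → B (fs r) (fs c))))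

Iℚ : ∀ {n} → Mat ℚ n n
Iℚ = Aℚ idℤ

Iℚ-isIdentity : ∀ {n} → ℚM.IsIdentity (Iℚ {n})
Iℚ-isIdentity = cong toℚ ∘ idℤ-diag , λ i j i≢j → cong toℚ (idℤ-off i j i≢j)

·ℚ-identity : ∀ {n} (x : Vecℚ n) → Iℚ ·ℚ x ≗ x
·ℚ-identity x i = ℚM.⊗-identityˡ Iℚ-isIdentity (column x) i fz

unimodular-ℚ : ∀ {n} {U : Mat ℤ n n} (U-unimodular : Unimodular U) →
  (Aℚ U *ℚ Aℚ (proj₁ U-unimodular)) ≈M Iℚ × (Aℚ (proj₁ U-unimodular) *ℚ Aℚ U) ≈M Iℚ
unimodular-ℚ {U = U} (U' , UU' , U'U) =
  ≈M-trans (≈M-sym (Aℚ-* U U')) (λ i j → cong toℚ (UU' i j)) ,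
  ≈M-trans (≈M-sym (Aℚ-* U' U)) (λ i j → cong toℚ (U'U i j))

module _ {m n} {A B : Mat ℤ m n} (A∼B : A ∼ B) where

  open _∼_ A∼B
  open SetoidReasoning (Mat-setoid ℚ m n)

  UAV≈B-ℚ : ((Aℚ U *ℚ Aℚ A) *ℚ Aℚ V) ≈M Aℚ B
  UAV≈B-ℚ = begin
    (Aℚ U *ℚ Aℚ A) *ℚ Aℚ V  ≈⟨ ℚM.⊗-congˡ (Aℚ V) (Aℚ-* U A) ⟨
    Aℚ (U *ℤ A) *ℚ Aℚ V     ≈⟨ Aℚ-* (U *ℤ A) V ⟨
    Aℚ ((U *ℤ A) *ℤ V)      ≈⟨ (λ i j → cong toℚ (UAV≈B i j)) ⟩
    Aℚ B                    ∎

  AV≈U⁻¹B : (Aℚ A *ℚ Aℚ V) ≈M (Aℚ U⁻¹ *ℚ Aℚ B)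
  AV≈U⁻¹B = begin
    Aℚ A *ℚ Aℚ V                          ≈⟨ ℚM.⊗-identityˡ Iℚ-isIdentity _ ⟨
    Iℚ *ℚ (Aℚ A *ℚ Aℚ V)                  ≈⟨ ℚM.⊗-congˡ (Aℚ A *ℚ Aℚ V) (proj₂ (unimodular-ℚ U-unimodular)) ⟨
    (Aℚ U⁻¹ *ℚ Aℚ U) *ℚ (Aℚ A *ℚ Aℚ V)    ≈⟨ ℚM.⊗-assoc (Aℚ U⁻¹) (Aℚ U) _ ⟩
    Aℚ U⁻¹ *ℚ (Aℚ U *ℚ (Aℚ A *ℚ Aℚ V))    ≈⟨ ℚM.⊗-congʳ (Aℚ U⁻¹) (ℚM.⊗-assoc (Aℚ U) (Aℚ A) (Aℚ V)) ⟨
    Aℚ U⁻¹ *ℚ ((Aℚ U *ℚ Aℚ A) *ℚ Aℚ V)    ≈⟨ ℚM.⊗-congʳ (Aℚ U⁻¹) UAV≈B-ℚ ⟩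
    Aℚ U⁻¹ *ℚ Aℚ B                        ∎

  UA≈BV⁻¹ : (Aℚ U *ℚ Aℚ A) ≈M (Aℚ B *ℚ Aℚ V⁻¹)
  UA≈BV⁻¹ = begin
    Aℚ U *ℚ Aℚ A                          ≈⟨ ℚM.⊗-identityʳ Iℚ-isIdentity _ ⟨
    (Aℚ U *ℚ Aℚ A) *ℚ Iℚ                  ≈⟨ ℚM.⊗-congʳ (Aℚ U *ℚ Aℚ A) (proj₁ (unimodular-ℚ V-unimodular)) ⟨
    (Aℚ U *ℚ Aℚ A) *ℚ (Aℚ V *ℚ Aℚ V⁻¹)    ≈⟨ ℚM.⊗-assoc (Aℚ U *ℚ Aℚ A) (Aℚ V) (Aℚ V⁻¹) ⟨
    ((Aℚ U *ℚ Aℚ A) *ℚ Aℚ V) *ℚ Aℚ V⁻¹    ≈⟨ ℚM.⊗-congˡ (Aℚ V⁻¹) UAV≈B-ℚ ⟩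
    Aℚ B *ℚ Aℚ V⁻¹                        ∎

minors-∣-∼ : ∀ {m n k} {A B : Mat ℤ m n} {d : ℤ} → A ∼ B →
  (∀ (s : Fin k → Fin m) (t : Fin k → Fin n) → d ∣ℤ minor A s t) →
  ∀ (s : Fin k → Fin m) (t : Fin k → Fin n) → d ∣ℤ minor B s t
minors-∣-∼ {A = A} {d = d} A∼B d∣A s t =
  subst (d ∣ℤ_) (det-cong (λ i j → UAV≈B (s i) (t j))) (minors-∣-*ʳ (U *ℤ A) V (minors-∣-*ˡ U A d∣A) s t)
  where open _∼_ A∼B

-- A k-minor either uses a column of index ≥ L, or, by pigeonhole, repeats a column.
minors-∣-of-tail-cols : ∀ {m n k} (M : Mat ℤ m n) (L : ℕ) {d : ℤ} → L ℕ.< k →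
  (∀ i j → L ℕ.≤ toℕ j → d ∣ℤ M i j) → ∀ (s : Fin k → Fin m) (t : Fin k → Fin n) → d ∣ℤ minor M s t
minors-∣-of-tail-cols {k = k} M L {d} L<k d∣tail s t with all? (λ j → toℕ (t j) ℕP.<? L)
... | no ¬all< = let (j , t-j≮L) = ¬∀⟶∃¬ k _ (λ j → toℕ (t j) ℕP.<? L) ¬all< in
                 ∣-det-col (λ a b → M (s a) (t b)) j (λ i → d∣tail (s i) (t j) (ℕP.≮⇒≥ t-j≮L))
... | yes all< = let (i , j , i<j , same) = FinP.pigeonhole L<k (λ j → fromℕ< (all< j)) in
  subst (d ∣ℤ_) (sym (det-equal-cols (λ a b → M (s a) (t b)) i j (λ i≡j → ℕP.<-irrefl (cong toℕ i≡j) i<j)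
                                     (λ r → cong (M (s r)) (t-i≡t-j i j same))))
        ∣ℤ0
  where
  t-i≡t-j : ∀ i j → fromℕ< (all< i) ≡ fromℕ< (all< j) → t i ≡ t j
  t-i≡t-j i j same = FinP.toℕ-injective
    (trans (sym (FinP.toℕ-fromℕ< (all< i))) (trans (cong toℕ same) (FinP.toℕ-fromℕ< (all< j))))

snf-zero-col : ∀ {m n r} {D : Mat ℤ m n} {δ : Fin r → ℕ} → IsSNF D δ → ∀ i j → r ℕ.≤ toℕ j → D i j ≡ + 0
snf-zero-col (_ , _ , off , beyond , _) i j r≤j with toℕ i ℕ.≟ toℕ j
... | yes i≡j = beyond i j i≡j (subst (_ ℕ.≤_) (sym i≡j) r≤j)
... | no i≢j = off i j i≢j

snf-zero-row : ∀ {m n r} {D : Mat ℤ m n} {δ : Fin r → ℕ} → IsSNF D δ → ∀ i j → r ℕ.≤ toℕ i → D i j ≡ + 0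
snf-zero-row (_ , _ , off , beyond , _) i j r≤i with toℕ i ℕ.≟ toℕ j
... | yes i≡j = beyond i j i≡j r≤i
... | no i≢j = off i j i≢j

snf-leading-minor : ∀ {m n r} {D : Mat ℤ m n} {δ : Fin r → ℕ} → IsSNF D δ →
  ∀ {k} (k≤m : k ℕ.≤ m) (k≤n : k ℕ.≤ n) (k≤r : k ℕ.≤ r) →
  minor D (λ i → inject≤ i k≤m) (λ i → inject≤ i k≤n) ≡ + ∏ (λ i → δ (inject≤ i k≤r))
snf-leading-minor (_ , _ , off , _ , diag) k≤m k≤n k≤r = det-diagonal _ _
  (λ i j i≢j → off _ _ (λ eq → i≢j (FinP.toℕ-injective
    (trans (sym (FinP.toℕ-inject≤ i k≤m)) (trans eq (FinP.toℕ-inject≤ j k≤n))))))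
  (λ i → diag (inject≤ i k≤r) _ _ (same k≤m i) (same k≤n i))
  where
  same : ∀ {a} (k≤a : _ ℕ.≤ a) i → toℕ (inject≤ i k≤a) ≡ toℕ (inject≤ i k≤r)
  same k≤a i = trans (FinP.toℕ-inject≤ i k≤a) (sym (FinP.toℕ-inject≤ i k≤r))

-- Diagonal matrices

AllPowersOf : ℕ → ∀ {r} → (Fin r → ℕ) → Set
AllPowersOf p δ = ∀ k → IsPowerOf p (δ k)

PadicGeneralizedInverse : ℕ → ∀ {m n} → Mat ℤ m n → Set
PadicGeneralizedInverse p {m} {n} A =
  Σ (Mat ℚ n m) λ B → (∀ i j → IsPadic p (B i j)) × (((Aℚ A *ℚ B) *ℚ Aℚ A) ≈M Aℚ A)

module Diagonal {m n r} {D : Mat ℤ m n} {δ : Fin r → ℕ} (D-snf : IsSNF D δ) (r≤m : r ℕ.≤ m) (r≤n : r ℕ.≤ n) where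

  ι : Fin r → Fin m
  ι k = inject≤ k r≤m

  κ : Fin r → Fin n
  κ k = inject≤ k r≤n

  private
    δ-pos = proj₁ D-snf
    off-diag = proj₁ (proj₂ (proj₂ D-snf))

    ι≢-κ : ∀ {i k} → i ≢ ι k → toℕ i ≢ toℕ (κ k)
    ι≢-κ {i} {k} i≢ιk eq = i≢ιk (FinP.toℕ-injective
      (trans eq (trans (FinP.toℕ-inject≤ k r≤n) (sym (FinP.toℕ-inject≤ k r≤m)))))

  κ-injective : ∀ {k k'} → κ k ≡ κ k' → k ≡ k'
  κ-injective {k} {k'} eq = FinP.toℕ-injective
    (trans (sym (FinP.toℕ-inject≤ k r≤n)) (trans (cong toℕ eq) (FinP.toℕ-inject≤ k' r≤n)))

  DQ : Mat ℚ m n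
  DQ = Aℚ D

  δ⁻¹ : Fin r → ℚ
  δ⁻¹ k = recip (δ k) {{ℕ.>-nonZero (δ-pos k)}}

  δ*δ⁻¹ : ∀ k → toℚ (+ δ k) ℚ.* δ⁻¹ k ≡ 1ℚ
  δ*δ⁻¹ k = toℚ-*-recip (δ k) {{ℕ.>-nonZero (δ-pos k)}}

  D-diag : ∀ k → D (ι k) (κ k) ≡ + δ k
  D-diag k = snf-diag D-snf k r≤m r≤n

  D-col : ∀ i k → D i (κ k) ≡ idℤ i (ι k) ℤ.* + δ k
  D-col i k with i ≟ ι k
  ... | yes refl = trans (D-diag k) (sym (trans (cong (ℤ._* + δ k) (idℤ-diag (ι k))) (ℤP.*-identityˡ _)))
  ... | no i≢ιk = trans (off-diag i (κ k) (ι≢-κ i≢ιk)) (sym (cong (ℤ._* + δ k) (idℤ-off i (ι k) i≢ιk)))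

  D-row : ∀ k j → D (ι k) j ≡ idℤ (κ k) j ℤ.* + δ k
  D-row k j with j ≟ κ k
  ... | yes refl = trans (D-diag k) (sym (trans (cong (ℤ._* + δ k) (idℤ-diag (κ k))) (ℤP.*-identityˡ _)))
  ... | no j≢κk = trans (off-diag (ι k) j (ι≢-κ′ ∘ sym)) (sym (cong (ℤ._* + δ k) (idℤ-off (κ k) j (j≢κk ∘ sym))))
    where
    ι≢-κ′ : toℕ j ≢ toℕ (ι k)
    ι≢-κ′ eq = j≢κk (FinP.toℕ-injective (trans eq (trans (FinP.toℕ-inject≤ k r≤m) (sym (FinP.toℕ-inject≤ k r≤n)))))

  diagonal-or-beyond : ∀ {l} (emb : Fin r → Fin l) → (∀ k → toℕ (emb k) ≡ toℕ k) →
    ∀ i → (Σ (Fin r) λ k → emb k ≡ i) ⊎ (r ℕ.≤ toℕ i)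
  diagonal-or-beyond emb emb-toℕ i with toℕ i ℕP.<? r
  ... | yes i<r = inj₁ (fromℕ< i<r , FinP.toℕ-injective (trans (emb-toℕ _) (FinP.toℕ-fromℕ< i<r)))
  ... | no i≮r = inj₂ (ℕP.≮⇒≥ i≮r)

  row-∑ : ∀ k (f : Vecℚ n) → sumℚ (λ t → DQ (ι k) t ℚ.* f t) ≡ toℚ (+ δ k) ℚ.* f (κ k)
  row-∑ k f = trans
    (ℚM.∑-single _ (κ k) (λ t t≢κk → trans (cong (λ z → toℚ z ℚ.* f t)
                                               (trans (D-row k t) (cong (ℤ._* + δ k) (idℤ-off (κ k) t (t≢κk ∘ sym)))))
                                         (ℚP.*-zeroˡ (f t))))
    (cong (λ z → toℚ z ℚ.* f (κ k)) (D-diag k))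

  col-∑ : ∀ k (f : Vecℚ m) → sumℚ (λ i → f i ℚ.* DQ i (κ k)) ≡ f (ι k) ℚ.* toℚ (+ δ k)
  col-∑ k f = trans
    (ℚM.∑-single _ (ι k) (λ i i≢ιk → trans (cong (λ z → f i ℚ.* toℚ z)
                                               (trans (D-col i k) (cong (ℤ._* + δ k) (idℤ-off i (ι k) i≢ιk))))
                                         (ℚP.*-zeroʳ (f i))))
    (cong (λ z → f (ι k) ℚ.* toℚ z) (D-diag k))

  row-∑-beyond : ∀ i → r ℕ.≤ toℕ i → ∀ (f : Vecℚ n) → sumℚ (λ t → DQ i t ℚ.* f t) ≡ 0ℚ
  row-∑-beyond i r≤i f = ℚM.∑-zero _ (λ t → trans (cong (λ z → toℚ z ℚ.* f t) (snf-zero-row D-snf i t r≤i)) (ℚP.*-zeroˡ (f t)))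

  e : Fin r → Vecℚ n
  e k j = toℚ (idℤ j (κ k)) ℚ.* δ⁻¹ k

  eʳ : Fin r → Vecℚ m
  eʳ k i = toℚ (idℤ i (ι k)) ℚ.* δ⁻¹ k

  D·e : ∀ k → DQ ·ℚ e k ≗ λ i → toℚ (idℤ i (ι k))
  D·e k i = begin
    sumℚ (λ t → DQ i t ℚ.* (toℚ (idℤ t (κ k)) ℚ.* δ⁻¹ k))   ≡⟨ ℚM.∑-cong (λ t → ℚP.*-assoc (DQ i t) _ (δ⁻¹ k)) ⟨
    sumℚ (λ t → DQ i t ℚ.* toℚ (idℤ t (κ k)) ℚ.* δ⁻¹ k)     ≡⟨ ℚM.*-distribʳ-∑ (δ⁻¹ k) (λ t → DQ i t ℚ.* toℚ (idℤ t (κ k))) ⟨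
    (DQ *ℚ Iℚ) i (κ k) ℚ.* δ⁻¹ k                            ≡⟨ cong (ℚ._* δ⁻¹ k) (ℚM.⊗-identityʳ Iℚ-isIdentity DQ i (κ k)) ⟩
    toℚ (D i (κ k)) ℚ.* δ⁻¹ k                               ≡⟨ cong (λ z → toℚ z ℚ.* δ⁻¹ k) (D-col i k) ⟩
    toℚ (idℤ i (ι k) ℤ.* + δ k) ℚ.* δ⁻¹ k                   ≡⟨ cong (ℚ._* δ⁻¹ k) (toℚ-* (idℤ i (ι k)) (+ δ k)) ⟩
    toℚ (idℤ i (ι k)) ℚ.* toℚ (+ δ k) ℚ.* δ⁻¹ k             ≡⟨ ℚP.*-assoc (toℚ (idℤ i (ι k))) _ _ ⟩
    toℚ (idℤ i (ι k)) ℚ.* (toℚ (+ δ k) ℚ.* δ⁻¹ k)           ≡⟨ cong (toℚ (idℤ i (ι k)) ℚ.*_) (δ*δ⁻¹ k) ⟩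
    toℚ (idℤ i (ι k)) ℚ.* 1ℚ                                ≡⟨ ℚP.*-identityʳ _ ⟩
    toℚ (idℤ i (ι k))                                       ∎
    where open ≡-Reasoning

  eʳ·D : ∀ k → eʳ k ᵀ·ℚ DQ ≗ λ j → toℚ (idℤ (κ k) j)
  eʳ·D k j = begin
    sumℚ (λ i → toℚ (idℤ i (ι k)) ℚ.* δ⁻¹ k ℚ.* DQ i j)     ≡⟨ ℚM.∑-cong (λ i → swap-δ⁻¹ (toℚ (idℤ i (ι k))) (toℚ (idℤ (ι k) i))
                                                                                       (cong toℚ (idℤ-sym i (ι k))) (DQ i j)) ⟩
    sumℚ (λ i → toℚ (idℤ (ι k) i) ℚ.* DQ i j ℚ.* δ⁻¹ k)     ≡⟨ ℚM.*-distribʳ-∑ (δ⁻¹ k) (λ i → toℚ (idℤ (ι k) i) ℚ.* DQ i j) ⟨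
    (Iℚ *ℚ DQ) (ι k) j ℚ.* δ⁻¹ k                            ≡⟨ cong (ℚ._* δ⁻¹ k) (ℚM.⊗-identityˡ Iℚ-isIdentity DQ (ι k) j) ⟩
    toℚ (D (ι k) j) ℚ.* δ⁻¹ k                               ≡⟨ cong (λ z → toℚ z ℚ.* δ⁻¹ k) (D-row k j) ⟩
    toℚ (idℤ (κ k) j ℤ.* + δ k) ℚ.* δ⁻¹ k                   ≡⟨ cong (ℚ._* δ⁻¹ k) (toℚ-* (idℤ (κ k) j) (+ δ k)) ⟩
    toℚ (idℤ (κ k) j) ℚ.* toℚ (+ δ k) ℚ.* δ⁻¹ k             ≡⟨ ℚP.*-assoc (toℚ (idℤ (κ k) j)) _ _ ⟩
    toℚ (idℤ (κ k) j) ℚ.* (toℚ (+ δ k) ℚ.* δ⁻¹ k)           ≡⟨ cong (toℚ (idℤ (κ k) j) ℚ.*_) (δ*δ⁻¹ k) ⟩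
    toℚ (idℤ (κ k) j) ℚ.* 1ℚ                                ≡⟨ ℚP.*-identityʳ _ ⟩
    toℚ (idℤ (κ k) j)                                       ∎
    where
    open ≡-Reasoning
    swap-δ⁻¹ : ∀ a a' → a ≡ a' → ∀ x → a ℚ.* δ⁻¹ k ℚ.* x ≡ a' ℚ.* x ℚ.* δ⁻¹ k
    swap-δ⁻¹ a .a refl x = trans (ℚP.*-assoc a (δ⁻¹ k) x) (trans (cong (a ℚ.*_) (ℚP.*-comm (δ⁻¹ k) x)) (sym (ℚP.*-assoc a x (δ⁻¹ k))))

module DiagonalConditions (p : ℕ) (p-prime : Prime p)
  {m n r} {D : Mat ℤ m n} {δ : Fin r → ℕ} (D-snf : IsSNF D δ) (r≤m : r ℕ.≤ m) (r≤n : r ℕ.≤ n) where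

  open Diagonal D-snf r≤m r≤n

  private
    δ⁻¹-padic : AllPowersOf p δ → ∀ k → IsPadic p (δ⁻¹ k)
    δ⁻¹-padic powers k = padic-by-power p (δ⁻¹ k) (+ 1) (powers k) (trans (ℚP.*-comm (δ⁻¹ k) _) (δ*δ⁻¹ k))

  -- Each e k solves D x = (unit vector at ι k); a p-adic solution forces δ k to be a power of p.
  cols⇒powers : ColsPadicGen p D → AllPowersOf p δ
  cols⇒powers gen k = inverse-padic⇒IsPowerOf p p-prime δμ≡1 (μ-padic (κ k))
    where
    solution = gen (λ i → idℤ i (ι k)) (e k , D·e k)
    μ = proj₁ solution
    μ-padic = proj₁ (proj₂ solution)
    δμ≡1 : toℚ (+ δ k) ℚ.* μ (κ k) ≡ 1ℚ
    δμ≡1 = trans (sym (row-∑ k μ)) (trans (proj₂ (proj₂ solution) (ι k)) (cong toℚ (idℤ-diag (ι k))))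

  powers⇒cols : AllPowersOf p δ → ColsPadicGen p D
  powers⇒cols powers v (λs , Dλ≡v) = μ , μ-padic , Dμ≡v
    where
    μ : Vecℚ n
    μ j = if does (toℕ j ℕP.<? r) then λs j else 0ℚ
    μ-padic : ∀ j → IsPadic p (μ j)
    μ-padic j with diagonal-or-beyond κ (λ k → FinP.toℕ-inject≤ k r≤n) j
    ... | inj₂ r≤j rewrite dec-false (toℕ j ℕP.<? r) (ℕP.≤⇒≯ r≤j) = padic-toℚ p (+ 0)
    ... | inj₁ (k , refl) rewrite dec-true (toℕ (κ k) ℕP.<? r) (subst (ℕ._< r) (sym (FinP.toℕ-inject≤ k r≤n)) (FinP.toℕ<n k)) =
      padic-by-power p (λs (κ k)) (v (ι k)) (powers k) (trans (ℚP.*-comm (λs (κ k)) _) (trans (sym (row-∑ k λs)) (Dλ≡v (ι k))))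
    Dμ≡v : ∀ i → (DQ ·ℚ μ) i ≡ toℚ (v i)
    Dμ≡v i = trans (ℚM.∑-cong same-terms) (Dλ≡v i)
      where
      same-terms : ∀ t → DQ i t ℚ.* μ t ≡ DQ i t ℚ.* λs t
      same-terms t with toℕ t ℕP.<? r
      ... | yes t<r rewrite dec-true (toℕ t ℕP.<? r) t<r = refl
      ... | no t≮r rewrite dec-false (toℕ t ℕP.<? r) t≮r = trans (cong (λ z → toℚ z ℚ.* 0ℚ) D-it≡0)
                           (sym (trans (cong (λ z → toℚ z ℚ.* λs t) D-it≡0) (ℚP.*-zeroˡ (λs t))))
        where
        D-it≡0 = snf-zero-col D-snf i t (ℕP.≮⇒≥ t≮r)

  -- With x = e k and y = eʳ k both products are integral, and yᵀ D x = 1 / δ k.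
  dual⇒powers : DualPadic p D → AllPowersOf p δ
  dual⇒powers dual k = inverse-padic⇒IsPowerOf p p-prime (δ*δ⁻¹ k)
    (subst (IsPadic p) eʳDe≡δ⁻¹ (dual (e k) (eʳ k) (λ j → idℤ (κ k) j , eʳ·D k j) (λ i → idℤ i (ι k) , D·e k i)))
    where
    eʳDe≡δ⁻¹ : dotℚ (eʳ k) (DQ ·ℚ e k) ≡ δ⁻¹ k
    eʳDe≡δ⁻¹ = trans (ℚM.∑-cong (λ i → cong (eʳ k i ℚ.*_) (D·e k i)))
      (trans (ℚM.∑-single _ (ι k) (λ i i≢ιk → trans (cong (λ z → toℚ z ℚ.* δ⁻¹ k ℚ.* toℚ z) (idℤ-off i (ι k) i≢ιk))
                                                        (ℚP.*-zeroʳ (toℚ (+ 0) ℚ.* δ⁻¹ k))))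
             (trans (cong (λ z → toℚ z ℚ.* δ⁻¹ k ℚ.* toℚ z) (idℤ-diag (ι k))) (trans (ℚP.*-identityʳ _) (ℚP.*-identityˡ _))))

  powers⇒dual : AllPowersOf p δ → DualPadic p D
  powers⇒dual powers x y yD-int Dx-int = padic-∑ p _ term-padic
    where
    term-padic : ∀ i → IsPadic p (y i ℚ.* (DQ ·ℚ x) i)
    term-padic i with diagonal-or-beyond ι (λ k → FinP.toℕ-inject≤ k r≤m) i
    ... | inj₂ r≤i = subst (IsPadic p) (sym (trans (cong (y i ℚ.*_) (row-∑-beyond i r≤i x)) (ℚP.*-zeroʳ (y i))))
                           (padic-toℚ p (+ 0))
    ... | inj₁ (k , refl) = padic-* p (y (ι k)) _ y-padic
                              (subst (IsPadic p) (sym (proj₂ (Dx-int (ι k)))) (padic-toℚ p (proj₁ (Dx-int (ι k)))))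
      where
      y-padic : IsPadic p (y (ι k))
      y-padic = padic-by-power p (y (ι k)) (proj₁ (yD-int (κ k))) (powers k) (trans (sym (col-∑ k y)) (proj₂ (yD-int (κ k))))

  inverse⇒powers : PadicGeneralizedInverse p D → AllPowersOf p δ
  inverse⇒powers (B , B-padic , DBD≈D) k = inverse-padic⇒IsPowerOf p p-prime db≡1 (B-padic (κ k) (ι k))
    where
    d = toℚ (+ δ k)
    b = B (κ k) (ι k)
    dbd≡d : (d ℚ.* b) ℚ.* d ≡ d
    dbd≡d = trans (sym (cong (ℚ._* d) (row-∑ k (λ t → B t (ι k)))))
                  (trans (sym (col-∑ k (λ l → (DQ *ℚ B) (ι k) l))) (trans (DBD≈D (ι k) (κ k)) (cong toℚ (D-diag k))))
    db≡1 : d ℚ.* b ≡ 1ℚ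
    db≡1 = begin
      d ℚ.* b                          ≡⟨ ℚP.*-identityʳ _ ⟨
      (d ℚ.* b) ℚ.* 1ℚ                 ≡⟨ cong ((d ℚ.* b) ℚ.*_) (δ*δ⁻¹ k) ⟨
      (d ℚ.* b) ℚ.* (d ℚ.* δ⁻¹ k)      ≡⟨ ℚP.*-assoc (d ℚ.* b) d (δ⁻¹ k) ⟨
      ((d ℚ.* b) ℚ.* d) ℚ.* δ⁻¹ k      ≡⟨ cong (ℚ._* δ⁻¹ k) dbd≡d ⟩
      d ℚ.* δ⁻¹ k                      ≡⟨ δ*δ⁻¹ k ⟩
      1ℚ                               ∎
      where open ≡-Reasoning

  powers⇒inverse : AllPowersOf p δ → PadicGeneralizedInverse p D
  powers⇒inverse powers = B , B-padic , DBD≈D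
    where
    B : Mat ℚ n m
    B j i = sumℚ (λ k → toℚ (idℤ j (κ k)) ℚ.* eʳ k i)
    B-padic : ∀ j i → IsPadic p (B j i)
    B-padic j i = padic-∑ p _ (λ k → padic-* p (toℚ (idℤ j (κ k))) (eʳ k i) (padic-toℚ p (idℤ j (κ k)))
                                       (padic-* p (toℚ (idℤ i (ι k))) (δ⁻¹ k) (padic-toℚ p (idℤ i (ι k))) (δ⁻¹-padic powers k)))
    B-row : ∀ k i → B (κ k) i ≡ eʳ k i
    B-row k i = trans
      (ℚM.∑-single _ k (λ k' k'≢k → trans (cong (λ z → toℚ z ℚ.* eʳ k' i) (idℤ-off (κ k) (κ k') (k'≢k ∘ sym ∘ κ-injective)))
                                          (ℚP.*-zeroˡ (eʳ k' i))))
      (trans (cong (λ z → toℚ z ℚ.* eʳ k i) (idℤ-diag (κ k))) (ℚP.*-identityˡ _))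
    DB-row : ∀ k i → (DQ *ℚ B) (ι k) i ≡ Iℚ (ι k) i
    DB-row k i = begin
      (DQ *ℚ B) (ι k) i                                      ≡⟨ row-∑ k (λ t → B t i) ⟩
      toℚ (+ δ k) ℚ.* B (κ k) i                              ≡⟨ cong (toℚ (+ δ k) ℚ.*_) (B-row k i) ⟩
      toℚ (+ δ k) ℚ.* (toℚ (idℤ i (ι k)) ℚ.* δ⁻¹ k)
        ≡⟨ ℚSolver.solve 3 (λ d a x → d :* (a :* x) := a :* (d :* x)) refl (toℚ (+ δ k)) (toℚ (idℤ i (ι k))) (δ⁻¹ k) ⟩
      toℚ (idℤ i (ι k)) ℚ.* (toℚ (+ δ k) ℚ.* δ⁻¹ k)          ≡⟨ cong (toℚ (idℤ i (ι k)) ℚ.*_) (δ*δ⁻¹ k) ⟩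
      toℚ (idℤ i (ι k)) ℚ.* 1ℚ                               ≡⟨ ℚP.*-identityʳ _ ⟩
      toℚ (idℤ i (ι k))                                      ≡⟨ cong toℚ (idℤ-sym i (ι k)) ⟩
      Iℚ (ι k) i                                             ∎
      where
      open ≡-Reasoning
      open ℚSolver
    DBD≈D : ((DQ *ℚ B) *ℚ DQ) ≈M DQ
    DBD≈D i j with diagonal-or-beyond ι (λ k → FinP.toℕ-inject≤ k r≤m) i
    ... | inj₂ r≤i = trans (ℚM.∑-zero _ (λ l → trans (cong (ℚ._* DQ l j) (row-∑-beyond i r≤i (λ t → B t l))) (ℚP.*-zeroˡ (DQ l j))))
                           (sym (cong toℚ (snf-zero-row D-snf i j r≤i)))
    ... | inj₁ (k , refl) = trans (ℚM.∑-cong (λ l → cong (ℚ._* DQ l j) (DB-row k l)))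
                                  (ℚM.⊗-identityˡ Iℚ-isIdentity DQ (ι k) j)

-- Invariance of the conditions under unimodular equivalence

module _ {m n} {A B : Mat ℤ m n} (A∼B : A ∼ B) (p : ℕ) where

  open _∼_ A∼B
  private
    AQ = Aℚ A
    BQ = Aℚ B
    UQ = Aℚ U
    VQ = Aℚ V
    U⁻¹Q = Aℚ U⁻¹
    V⁻¹Q = Aℚ V⁻¹

  -- w = B λ gives U⁻¹ w = A (V λ); a p-adic μ with A μ = U⁻¹ w yields B (V⁻¹ μ) = w.
  cols-∼ : ColsPadicGen p A → ColsPadicGen p B
  cols-∼ gen w (λs , Bλ≡w) = V⁻¹Q ·ℚ μ , padic-·ℚ p V⁻¹ μ μ-padic , Bμ′≡w
    where
    open ≡-Reasoning
    w' : Vecℤ m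
    w' i = sumℤ (λ j → U⁻¹ i j ℤ.* w j)
    AVλ≡w' : ∀ i → (AQ ·ℚ (VQ ·ℚ λs)) i ≡ toℚ (w' i)
    AVλ≡w' i = begin
      (AQ ·ℚ (VQ ·ℚ λs)) i             ≡⟨ ·ℚ-* AQ VQ λs i ⟨
      ((AQ *ℚ VQ) ·ℚ λs) i             ≡⟨ ·ℚ-congˡ λs (AV≈U⁻¹B A∼B) i ⟩
      ((U⁻¹Q *ℚ BQ) ·ℚ λs) i           ≡⟨ ·ℚ-* U⁻¹Q BQ λs i ⟩
      (U⁻¹Q ·ℚ (BQ ·ℚ λs)) i           ≡⟨ ·ℚ-congʳ U⁻¹Q Bλ≡w i ⟩
      (U⁻¹Q ·ℚ (toℚ ∘ w)) i            ≡⟨ Aℚ-·ℚ U⁻¹ w i ⟩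
      toℚ (w' i)                       ∎
    solution = gen w' (VQ ·ℚ λs , AVλ≡w')
    μ = proj₁ solution
    μ-padic = proj₁ (proj₂ solution)
    Bμ′≡w : ∀ i → (BQ ·ℚ (V⁻¹Q ·ℚ μ)) i ≡ toℚ (w i)
    Bμ′≡w i = begin
      (BQ ·ℚ (V⁻¹Q ·ℚ μ)) i                 ≡⟨ ·ℚ-* BQ V⁻¹Q μ i ⟨
      ((BQ *ℚ V⁻¹Q) ·ℚ μ) i                 ≡⟨ ·ℚ-congˡ μ (UA≈BV⁻¹ A∼B) i ⟨
      ((UQ *ℚ AQ) ·ℚ μ) i                   ≡⟨ ·ℚ-* UQ AQ μ i ⟩
      (UQ ·ℚ (AQ ·ℚ μ)) i                   ≡⟨ ·ℚ-congʳ UQ (proj₂ (proj₂ solution)) i ⟩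
      (UQ ·ℚ (toℚ ∘ w')) i                  ≡⟨ ·ℚ-congʳ UQ (sym ∘ Aℚ-·ℚ U⁻¹ w) i ⟩
      (UQ ·ℚ (U⁻¹Q ·ℚ (toℚ ∘ w))) i         ≡⟨ ·ℚ-* UQ U⁻¹Q (toℚ ∘ w) i ⟨
      ((UQ *ℚ U⁻¹Q) ·ℚ (toℚ ∘ w)) i         ≡⟨ ·ℚ-congˡ (toℚ ∘ w) (proj₁ (unimodular-ℚ U-unimodular)) i ⟩
      (Iℚ ·ℚ (toℚ ∘ w)) i                   ≡⟨ ·ℚ-identity (toℚ ∘ w) i ⟩
      toℚ (w i)                             ∎

  -- Test A against x' = V x and y' = Uᵀ y.
  dual-∼ : DualPadic p A → DualPadic p B
  dual-∼ dual x y yB-int Bx-int = subst (IsPadic p) y'Ax'≡yBx (dual x' y' y'A-int Ax'-int)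
    where
    open ≡-Reasoning
    x' = VQ ·ℚ x
    y' = y ᵀ·ℚ UQ
    y'A-int : ∀ j → IsIntegral ((y' ᵀ·ℚ AQ) j)
    y'A-int j = subst IsIntegral (sym (trans (sym (ᵀ·ℚ-* y UQ AQ j)) (trans (ᵀ·ℚ-congʳ y (UA≈BV⁻¹ A∼B) j) (ᵀ·ℚ-* y BQ V⁻¹Q j))))
                      (ᵀ·ℚ-integral (y ᵀ·ℚ BQ) V⁻¹ yB-int j)
    Ax'-int : ∀ i → IsIntegral ((AQ ·ℚ x') i)
    Ax'-int i = subst IsIntegral (sym (trans (sym (·ℚ-* AQ VQ x i)) (trans (·ℚ-congˡ x (AV≈U⁻¹B A∼B) i) (·ℚ-* U⁻¹Q BQ x i))))
                      (·ℚ-integral U⁻¹ (BQ ·ℚ x) Bx-int i)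
    y'Ax'≡yBx : dotℚ y' (AQ ·ℚ x') ≡ dotℚ y (BQ ·ℚ x)
    y'Ax'≡yBx = begin
      dotℚ y' (AQ ·ℚ (VQ ·ℚ x))            ≡⟨ dotℚ-cong {x = y'} {x' = y'} (λ _ → refl) (λ i → sym (·ℚ-* AQ VQ x i)) ⟩
      dotℚ y' ((AQ *ℚ VQ) ·ℚ x)            ≡⟨ dotℚ-·ℚ y' (AQ *ℚ VQ) x ⟩
      dotℚ (y' ᵀ·ℚ (AQ *ℚ VQ)) x           ≡⟨ dotℚ-cong {y = x} {y' = x} (λ j → sym (ᵀ·ℚ-* y UQ (AQ *ℚ VQ) j)) (λ _ → refl) ⟩
      dotℚ (y ᵀ·ℚ (UQ *ℚ (AQ *ℚ VQ))) x    ≡⟨ dotℚ-cong {y = x} {y' = x} (ᵀ·ℚ-congʳ y (≈M-trans (≈M-sym (ℚM.⊗-assoc UQ AQ VQ)) (UAV≈B-ℚ A∼B)))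
                                                       (λ _ → refl) ⟩
      dotℚ (y ᵀ·ℚ BQ) x                    ≡⟨ dotℚ-·ℚ y BQ x ⟨
      dotℚ y (BQ ·ℚ x)                     ∎

  -- A X A = A gives B (V⁻¹ X U⁻¹) B = B.
  inverse-∼ : PadicGeneralizedInverse p A → PadicGeneralizedInverse p B
  inverse-∼ (X , X-padic , AXA≈A) = X' , X'-padic , BX'B≈B
    where
    open SetoidReasoning (Mat-setoid ℚ m n)
    X' = (V⁻¹Q *ℚ X) *ℚ U⁻¹Q
    X'-padic : ∀ i j → IsPadic p (X' i j)
    X'-padic = padic-*ℚ p (V⁻¹Q *ℚ X) U⁻¹Q (padic-*ℚ p V⁻¹Q X (λ i j → padic-toℚ p (V⁻¹ i j)) X-padic)
                                           (λ i j → padic-toℚ p (U⁻¹ i j))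
    BX'B≈B : ((BQ *ℚ X') *ℚ BQ) ≈M BQ
    BX'B≈B = begin
      (BQ *ℚ ((V⁻¹Q *ℚ X) *ℚ U⁻¹Q)) *ℚ BQ       ≈⟨ ℚM.⊗-congˡ BQ (ℚM.⊗-assoc BQ (V⁻¹Q *ℚ X) U⁻¹Q) ⟨
      ((BQ *ℚ (V⁻¹Q *ℚ X)) *ℚ U⁻¹Q) *ℚ BQ       ≈⟨ ℚM.⊗-congˡ BQ (ℚM.⊗-congˡ U⁻¹Q (ℚM.⊗-assoc BQ V⁻¹Q X)) ⟨
      (((BQ *ℚ V⁻¹Q) *ℚ X) *ℚ U⁻¹Q) *ℚ BQ       ≈⟨ ℚM.⊗-congˡ BQ (ℚM.⊗-congˡ U⁻¹Q (ℚM.⊗-congˡ X (UA≈BV⁻¹ A∼B))) ⟨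
      (((UQ *ℚ AQ) *ℚ X) *ℚ U⁻¹Q) *ℚ BQ         ≈⟨ ℚM.⊗-assoc ((UQ *ℚ AQ) *ℚ X) U⁻¹Q BQ ⟩
      ((UQ *ℚ AQ) *ℚ X) *ℚ (U⁻¹Q *ℚ BQ)         ≈⟨ ℚM.⊗-congʳ ((UQ *ℚ AQ) *ℚ X) (AV≈U⁻¹B A∼B) ⟨
      ((UQ *ℚ AQ) *ℚ X) *ℚ (AQ *ℚ VQ)           ≈⟨ ℚM.⊗-congˡ (AQ *ℚ VQ) (ℚM.⊗-assoc UQ AQ X) ⟩
      (UQ *ℚ (AQ *ℚ X)) *ℚ (AQ *ℚ VQ)           ≈⟨ ℚM.⊗-assoc UQ (AQ *ℚ X) (AQ *ℚ VQ) ⟩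
      UQ *ℚ ((AQ *ℚ X) *ℚ (AQ *ℚ VQ))           ≈⟨ ℚM.⊗-congʳ UQ (ℚM.⊗-assoc (AQ *ℚ X) AQ VQ) ⟨
      UQ *ℚ (((AQ *ℚ X) *ℚ AQ) *ℚ VQ)           ≈⟨ ℚM.⊗-congʳ UQ (ℚM.⊗-congˡ VQ AXA≈A) ⟩
      UQ *ℚ (AQ *ℚ VQ)                          ≈⟨ ℚM.⊗-assoc UQ AQ VQ ⟨
      (UQ *ℚ AQ) *ℚ VQ                          ≈⟨ UAV≈B-ℚ A∼B ⟩
      BQ                                        ∎

-- Rank

module _ {m n} {A : Mat ℤ m n} (snf : SmithNormalForm A) where

  open SmithNormalForm snf

  minors-vanish-above-rank : ∀ {k} → rank ℕ.< k → ∀ (s : Fin k → Fin m) (t : Fin k → Fin n) → minor A s t ≡ + 0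
  minors-vanish-above-rank r<k s t = ℤ∣.0∣⇒≡0 (minors-∣-∼ (∼-sym A∼D)
    (minors-∣-of-tail-cols D rank r<k (λ i j r≤j → subst (+ 0 ∣ℤ_) (sym (snf-zero-col isSNF i j r≤j)) ℤ∣.∣-refl)) s t)

  -- The leading k-minor of D is the nonzero product δ₁ ⋯ δ_k.
  vanishing-minors⇒rank< : ∀ k → (∀ (s : Fin k → Fin m) (t : Fin k → Fin n) → minor A s t ≡ + 0) → rank ℕ.< k
  vanishing-minors⇒rank< k minors≡0 with rank ℕP.<? k
  ... | yes r<k = r<k
  ... | no r≮k = ⊥-elim (ℕP.<-irrefl (sym (ℤP.+-injective (trans (sym leading) leading≡0)))
                                     (∏-positive _ (λ i → proj₁ isSNF (inject≤ i k≤r))))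
    where
    k≤r = ℕP.≮⇒≥ r≮k
    k≤m = ℕP.≤-trans k≤r rank≤m
    k≤n = ℕP.≤-trans k≤r rank≤n
    leading = snf-leading-minor isSNF k≤m k≤n k≤r
    leading≡0 : minor D (λ i → inject≤ i k≤m) (λ i → inject≤ i k≤n) ≡ + 0
    leading≡0 = ℤ∣.0∣⇒≡0 (minors-∣-∼ A∼D (λ s t → subst (+ 0 ∣ℤ_) (sym (minors≡0 s t)) ℤ∣.∣-refl) _ _)
    ∏-positive : ∀ {l} (f : Fin l → ℕ) → (∀ i → 1 ℕ.≤ f i) → 0 ℕ.< ∏ f
    ∏-positive {zero} f _ = s≤s z≤n
    ∏-positive {suc l} f f-pos = ℕP.*-mono-≤ (f-pos fz) (∏-positive (f ∘ fs) (f-pos ∘ fs))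

  open Diagonal isSNF rank≤m rank≤n

  -- Otherwise the column of V at index rank is a nonzero kernel vector, as that column of D is zero.
  independent⇒n≤rank : LinIndepCols (Aℚ A) id → n ℕ.≤ rank
  independent⇒n≤rank independent with rank ℕP.<? n
  ... | no r≮n = ℕP.≮⇒≥ r≮n
  ... | yes r<n = ⊥-elim (1≢0 (begin
    + 1                               ≡⟨ idℤ-diag b ⟨
    idℤ b b                           ≡⟨ proj₂ (proj₂ V-unimodular) b b ⟨
    (V⁻¹ *ℤ V) b b                    ≡⟨ ℤM.∑-zero _ (λ l → trans (cong (V⁻¹ b l ℤ.*_) (V-b≡0 l)) (ℤP.*-zeroʳ (V⁻¹ b l))) ⟩
    + 0                               ∎))
    where
    open ≡-Reasoning
    open _∼_ A∼D
    1≢0 : + 1 ≢ + 0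
    1≢0 ()
    b : Fin n
    b = fromℕ< r<n
    c : Vecℚ n
    c l = toℚ (V l b)
    Ac≡0 : ∀ i → sumℚ (λ l → c l ℚ.* Aℚ A i l) ≡ 0ℚ
    Ac≡0 i = begin
      sumℚ (λ l → c l ℚ.* Aℚ A i l)   ≡⟨ ℚM.∑-cong (λ l → ℚP.*-comm (c l) (Aℚ A i l)) ⟩
      (Aℚ A *ℚ Aℚ V) i b              ≡⟨ AV≈U⁻¹B A∼D i b ⟩
      (Aℚ U⁻¹ *ℚ DQ) i b              ≡⟨ ℚM.∑-zero _ (λ t → trans (cong (λ z → Aℚ U⁻¹ i t ℚ.* toℚ z)
                                              (snf-zero-col isSNF t b (ℕP.≤-reflexive (sym (FinP.toℕ-fromℕ< r<n)))))
                                              (ℚP.*-zeroʳ (Aℚ U⁻¹ i t))) ⟩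
      0ℚ                              ∎
    V-b≡0 : ∀ l → V l b ≡ + 0
    V-b≡0 l = toℚ-injective {V l b} {+ 0} (independent c Ac≡0 l)

  -- A c = 0 gives D (V⁻¹ c) = U A c = 0, and every coordinate of V⁻¹ c sits on the diagonal of D.
  rank≡n⇒independent : rank ≡ n → LinIndepCols (Aℚ A) id
  rank≡n⇒independent rank≡n c Ac≡0 l = begin
    c l                             ≡⟨ ·ℚ-identity c l ⟨
    (Iℚ ·ℚ c) l                     ≡⟨ ·ℚ-congˡ c (proj₁ (unimodular-ℚ V-unimodular)) l ⟨
    ((Aℚ V *ℚ Aℚ V⁻¹) ·ℚ c) l       ≡⟨ ·ℚ-* (Aℚ V) (Aℚ V⁻¹) c l ⟩
    (Aℚ V ·ℚ y) l                   ≡⟨ ℚM.∑-zero _ (λ t → trans (cong (Aℚ V l t ℚ.*_) (y≡0 t)) (ℚP.*-zeroʳ (Aℚ V l t))) ⟩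
    0ℚ                              ∎
    where
    open ≡-Reasoning
    open _∼_ A∼D
    y = Aℚ V⁻¹ ·ℚ c
    Dy≡0 : ∀ i → (DQ ·ℚ y) i ≡ 0ℚ
    Dy≡0 i = begin
      (DQ ·ℚ (Aℚ V⁻¹ ·ℚ c)) i       ≡⟨ ·ℚ-* DQ (Aℚ V⁻¹) c i ⟨
      ((DQ *ℚ Aℚ V⁻¹) ·ℚ c) i       ≡⟨ ·ℚ-congˡ c (UA≈BV⁻¹ A∼D) i ⟨
      ((Aℚ U *ℚ Aℚ A) ·ℚ c) i       ≡⟨ ·ℚ-* (Aℚ U) (Aℚ A) c i ⟩
      (Aℚ U ·ℚ (Aℚ A ·ℚ c)) i       ≡⟨ ℚM.∑-zero _ (λ t → trans (cong (Aℚ U i t ℚ.*_)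
                                            (trans (ℚM.∑-cong (λ l → ℚP.*-comm (Aℚ A t l) (c l))) (Ac≡0 t)))
                                            (ℚP.*-zeroʳ (Aℚ U i t))) ⟩
      0ℚ                            ∎
    y-κ≡0 : ∀ k → y (κ k) ≡ 0ℚ
    y-κ≡0 k = begin
      y (κ k)                                 ≡⟨ ℚP.*-identityˡ _ ⟨
      1ℚ ℚ.* y (κ k)                          ≡⟨ cong (ℚ._* y (κ k)) (trans (ℚP.*-comm (δ⁻¹ k) _) (δ*δ⁻¹ k)) ⟨
      (δ⁻¹ k ℚ.* toℚ (+ δ k)) ℚ.* y (κ k)     ≡⟨ ℚP.*-assoc (δ⁻¹ k) _ _ ⟩
      δ⁻¹ k ℚ.* (toℚ (+ δ k) ℚ.* y (κ k))     ≡⟨ cong (δ⁻¹ k ℚ.*_) (trans (sym (row-∑ k y)) (Dy≡0 (ι k))) ⟩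
      δ⁻¹ k ℚ.* 0ℚ                            ≡⟨ ℚP.*-zeroʳ (δ⁻¹ k) ⟩
      0ℚ                                      ∎
    y≡0 : ∀ t → y t ≡ 0ℚ
    y≡0 t = trans (cong y (sym κk≡t)) (y-κ≡0 k)
      where
      t<rank = subst (toℕ t ℕ.<_) (sym rank≡n) (FinP.toℕ<n t)
      k = fromℕ< t<rank
      κk≡t : κ k ≡ t
      κk≡t = FinP.toℕ-injective (trans (FinP.toℕ-inject≤ k rank≤n) (FinP.toℕ-fromℕ< t<rank))

-- A maximal independent set of columns has as many elements as D has nonzero diagonal entries:
-- its minors detect the rank on both sides.
HasRank⇒rank≡ : ∀ {m n r} {A : Mat ℤ m n} → HasRank A r → (snf : SmithNormalForm A) → SmithNormalForm.rank snf ≡ r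
HasRank⇒rank≡ {m} {n} {r} {A} ((s , independent) , no-larger) snf = ℕP.≤-antisym rank≤r r≤rank
  where
  open SmithNormalForm snf using (rank)
  columns : ∀ {k} → (Fin k → Fin n) → Mat ℤ m k
  columns t i l = A i (t l)
  r≤rank : r ℕ.≤ rank
  r≤rank with r ℕP.≤? rank
  ... | yes r≤rank = r≤rank
  ... | no r≰rank = ⊥-elim (ℕP.<-irrefl refl (ℕP.<-≤-trans
          (vanishing-minors⇒rank< (smith (columns s)) r (λ s' t' → minors-vanish-above-rank snf (ℕP.≰⇒> r≰rank) s' (s ∘ t')))
          (independent⇒n≤rank (smith (columns s)) independent)))
  rank≤r : rank ℕ.≤ r
  rank≤r with rank ℕP.≤? r
  ... | yes rank≤r = rank≤r
  ... | no rank≰r = ⊥-elim (ℕP.<-irrefl refl (ℕP.<-≤-trans (vanishing-minors⇒rank< snf (suc r) minors≡0) (ℕP.≰⇒> rank≰r)))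
    where
    minors≡0 : ∀ (s' : Fin (suc r) → Fin m) (t' : Fin (suc r) → Fin n) → minor A s' t' ≡ + 0
    minors≡0 s' t' with SmithNormalForm.rank (smith (columns t')) ℕP.≟ suc r
    ... | yes full = ⊥-elim (no-larger t' (rank≡n⇒independent (smith (columns t')) full))
    ... | no ¬full = minors-vanish-above-rank (smith (columns t'))
                       (ℕP.≤∧≢⇒< (SmithNormalForm.rank≤n (smith (columns t'))) ¬full) s' id

-- The gcd of the minors

gcdFin : ∀ {m} → (Fin m → ℕ) → ℕ
gcdFin {zero} h = 0
gcdFin {suc m} h = gcd (h fz) (gcdFin (h ∘ fs))

gcdFin-∣ : ∀ {m} (h : Fin m → ℕ) x → gcdFin h ∣ h x
gcdFin-∣ h fz = gcd[m,n]∣m (h fz) _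
gcdFin-∣ h (fs x) = ℕDiv.∣-trans (gcd[m,n]∣n (h fz) _) (gcdFin-∣ (h ∘ fs) x)

gcdFin-greatest : ∀ {m} (h : Fin m → ℕ) {d} → (∀ x → d ∣ h x) → d ∣ gcdFin h
gcdFin-greatest {zero} h {d} d∣h = d ℕDiv.∣0
gcdFin-greatest {suc m} h d∣h = gcd-greatest (d∣h fz) (gcdFin-greatest (h ∘ fs) (d∣h ∘ fs))

gcdFin-cong : ∀ {m} {h h' : Fin m → ℕ} → h ≗ h' → gcdFin h ≡ gcdFin h'
gcdFin-cong {zero} h≗h' = refl
gcdFin-cong {suc m} h≗h' = cong₂ gcd (h≗h' fz) (gcdFin-cong (h≗h' ∘ fs))

gcdMaps : ∀ r {m} → ((Fin r → Fin m) → ℕ) → ℕ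
gcdMaps zero F = F (λ ())
gcdMaps (suc r) F = gcdFin (λ x → gcdMaps r (λ f → F (x ∷ f)))

RespectsPointwise : ∀ {r m} → ((Fin r → Fin m) → ℕ) → Set
RespectsPointwise F = ∀ {f g} → f ≗ g → F f ≡ F g

gcdMaps-cong : ∀ r {m} {F F' : (Fin r → Fin m) → ℕ} → (∀ f → F f ≡ F' f) → gcdMaps r F ≡ gcdMaps r F'
gcdMaps-cong zero F≡F' = F≡F' _
gcdMaps-cong (suc r) F≡F' = gcdFin-cong (λ x → gcdMaps-cong r (λ f → F≡F' (x ∷ f)))

-- f and (f fz ∷ f ∘ fs) agree only pointwise, hence the hypothesis on F.
gcdMaps-∣ : ∀ r {m} (F : (Fin r → Fin m) → ℕ) → RespectsPointwise F → ∀ f → gcdMaps r F ∣ F f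
gcdMaps-∣ zero F F-resp f = ℕDiv.∣-reflexive (F-resp (λ ()))
gcdMaps-∣ (suc r) F F-resp f = ℕDiv.∣-trans (gcdFin-∣ _ (f fz))
  (ℕDiv.∣-trans (gcdMaps-∣ r (λ g → F (f fz ∷ g)) (λ f≗g → F-resp (λ { fz → refl ; (fs i) → f≗g i })) (f ∘ fs))
                (ℕDiv.∣-reflexive (F-resp (λ { fz → refl ; (fs i) → refl }))))

gcdMaps-greatest : ∀ r {m} (F : (Fin r → Fin m) → ℕ) {d} → (∀ f → d ∣ F f) → d ∣ gcdMaps r F
gcdMaps-greatest zero F d∣F = d∣F _
gcdMaps-greatest (suc r) F d∣F = gcdFin-greatest _ (λ x → gcdMaps-greatest r _ (λ f → d∣F (x ∷ f)))

gcd-minors : ∀ {m n} (A : Mat ℤ m n) r → Σ ℕ (IsGcdMinors A r)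
gcd-minors {m} {n} A r = g , g∣minors , λ d d∣minors → gcdMaps-greatest r _ (λ s → gcdMaps-greatest r _ (λ t → d∣minors s t))
  where
  g = gcdMaps r (λ s → gcdMaps r (λ t → ℤ.∣ minor A s t ∣))
  g∣minors : ∀ s t → (+ g) ℤD.∣ minor A s t
  g∣minors s t = ℕDiv.∣-trans
    (gcdMaps-∣ r _ (λ s≗s' → gcdMaps-cong r (λ t → cong ℤ.∣_∣ (det-cong (λ i j → cong (λ z → A z (t j)) (s≗s' i))))) s)
    (gcdMaps-∣ r _ (λ t≗t' → cong ℤ.∣_∣ (det-cong (λ i j → cong (A (s i)) (t≗t' j)))) t)

-- The equivalences

IsSNF-≈ : ∀ {m n r} {D D' : Mat ℤ m n} {δ : Fin r → ℕ} → D ≈M D' → IsSNF D δ → IsSNF D' δ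
IsSNF-≈ D≈D' (positive , chain , off , beyond , diag) =
  positive , chain ,
  (λ i j i≢j → trans (sym (D≈D' i j)) (off i j i≢j)) ,
  (λ i j i≡j r≤i → trans (sym (D≈D' i j)) (beyond i j i≡j r≤i)) ,
  (λ k i j i≡k j≡k → trans (sym (D≈D' i j)) (diag k i j i≡k j≡k))

IsSNF-transpose : ∀ {m n r} {D : Mat ℤ m n} {δ : Fin r → ℕ} → IsSNF D δ → IsSNF (transpose D) δ
IsSNF-transpose (positive , chain , off , beyond , diag) =
  positive , chain ,
  (λ i j i≢j → off j i (i≢j ∘ sym)) ,
  (λ i j i≡j r≤i → beyond j i (sym i≡j) (subst (_ ℕ.≤_) i≡j r≤i)) ,
  (λ k i j i≡k j≡k → diag k j i j≡k i≡k)

IsSNF-last-divides : ∀ {m n r} {D : Mat ℤ m n} {δ : Fin (suc r) → ℕ} → IsSNF D δ →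
  ∀ i j → r ℕ.≤ toℕ j → + δ (fromℕ r) ∣ℤ D i j
IsSNF-last-divides {r = r} D-snf@(_ , _ , off , _ , diag) i j r≤j with toℕ i ℕ.≟ toℕ j | toℕ j ℕP.<? suc r
... | no i≢j | _ = subst (_ ∣ℤ_) (sym (off i j i≢j)) ∣ℤ0
... | yes i≡j | yes j<1+r = subst (_ ∣ℤ_) (sym (diag (fromℕ r) i j (trans i≡j j≡r) j≡r)) ℤ∣.∣-refl
  where
  j≡r : toℕ j ≡ toℕ (fromℕ r)
  j≡r = trans (ℕP.≤-antisym (ℕP.≤-pred j<1+r) r≤j) (sym (FinP.toℕ-fromℕ r))
... | yes _ | no j≮1+r = subst (_ ∣ℤ_) (sym (snf-zero-col D-snf i j (ℕP.≮⇒≥ j≮1+r))) ∣ℤ0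

IsPowerOf-∏ : ∀ p {k} (f : Fin k → ℕ) → (∀ i → IsPowerOf p (f i)) → IsPowerOf p (∏ f)
IsPowerOf-∏ p {zero} f _ = 0 , refl
IsPowerOf-∏ p {suc k} f f-powers = IsPowerOf-* p (f-powers fz) (IsPowerOf-∏ p (f ∘ fs) (f-powers ∘ fs))

minor-divisors∣p^e⇒powers : ∀ p → Prime p → ∀ {m n r} {A D : Mat ℤ m n} {δ : Fin r → ℕ} → A ∼ D → IsSNF D δ →
  ∀ {e} → (∀ d → (∀ (s : Fin r → Fin m) (t : Fin r → Fin n) → (+ d) ℤD.∣ minor A s t) → d ∣ p ^ e) → AllPowersOf p δ
minor-divisors∣p^e⇒powers p p-prime {r = suc r} {δ = δ} A∼D D-snf {e} divisors∣p^e k =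
  prime-power-divisor p p-prime e (δ k) (ℕDiv.∣-trans (proj₁ (proj₂ D-snf) k (fromℕ r) k≤r) last∣p^e)
  where
  last∣p^e : δ (fromℕ r) ∣ p ^ e
  last∣p^e = divisors∣p^e (δ (fromℕ r)) (λ s t → ℤ∣.∣⇒∣ᵤ
    (minors-∣-∼ (∼-sym A∼D) (minors-∣-of-tail-cols _ r (ℕP.n<1+n r) (IsSNF-last-divides D-snf)) s t))
  k≤r : toℕ k ℕ.≤ toℕ (fromℕ r)
  k≤r = subst (toℕ k ℕ.≤_) (sym (FinP.toℕ-fromℕ r)) (ℕP.≤-pred (FinP.toℕ<n k))

Conclusion : ℕ → ∀ {m n} → ℕ → Mat ℤ m n → Set
Conclusion p {m} {n} r A =
  (ColsPadicGen p A ⇔ RowsPadicGen p A) ×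
  (ColsPadicGen p A ⇔ DualPadic p A) ×
  (ColsPadicGen p A ⇔ (∀ (δ : Fin r → ℕ) → ElemDivisors A δ → ∀ k → IsPowerOf p (δ k))) ×
  (ColsPadicGen p A ⇔ (Σ ℕ λ g → IsGcdMinors A r g × IsPowerOf p g)) ×
  (ColsPadicGen p A ⇔ PadicGeneralizedInverse p A)

module _ (p : ℕ) (p-prime : Prime p) {m n} (A : Mat ℤ m n) (snf : SmithNormalForm A) where

  open SmithNormalForm snf
  open DiagonalConditions p p-prime isSNF rank≤m rank≤n
  private
    module Dᵀ = DiagonalConditions p p-prime (IsSNF-transpose isSNF) rank≤n rank≤m

  cols⇔powers : ColsPadicGen p A ⇔ AllPowersOf p δ
  cols⇔powers = mk⇔ (cols⇒powers ∘ cols-∼ A∼D p) (cols-∼ (∼-sym A∼D) p ∘ powers⇒cols)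

  rows⇔powers : RowsPadicGen p A ⇔ AllPowersOf p δ
  rows⇔powers = mk⇔ (Dᵀ.cols⇒powers ∘ cols-∼ (∼-transpose A∼D) p) (cols-∼ (∼-sym (∼-transpose A∼D)) p ∘ Dᵀ.powers⇒cols)

  dual⇔powers : DualPadic p A ⇔ AllPowersOf p δ
  dual⇔powers = mk⇔ (dual⇒powers ∘ dual-∼ A∼D p) (dual-∼ (∼-sym A∼D) p ∘ powers⇒dual)

  inverse⇔powers : PadicGeneralizedInverse p A ⇔ AllPowersOf p δ
  inverse⇔powers = mk⇔ (inverse⇒powers ∘ inverse-∼ A∼D p) (inverse-∼ (∼-sym A∼D) p ∘ powers⇒inverse)

  elementary-divisors⇔powers : (∀ (δ' : Fin rank → ℕ) → ElemDivisors A δ' → AllPowersOf p δ') ⇔ AllPowersOf p δ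
  elementary-divisors⇔powers = mk⇔ (λ all-powers → all-powers δ ours) theirs
    where
    open _∼_ A∼D
    ours : ElemDivisors A δ
    ours = U , V , U-unimodular , V-unimodular , IsSNF-≈ (≈M-sym UAV≈B) isSNF
    theirs : AllPowersOf p δ → ∀ (δ' : Fin rank → ℕ) → ElemDivisors A δ' → AllPowersOf p δ'
    theirs powers δ' (U' , V' , U'-unimodular , V'-unimodular , δ'-snf) =
      DiagonalConditions.cols⇒powers p p-prime δ'-snf rank≤m rank≤n
        (cols-∼ (record { U = U' ; V = V' ; U-unimodular = U'-unimodular ; V-unimodular = V'-unimodular ; UAV≈B = ≈M-refl })
                p (Equivalence.from cols⇔powers powers))

  -- g divides the leading minor δ₁ ⋯ δ_rank of D; conversely the last δ divides every minor of that order.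
  gcd⇔powers : (Σ ℕ λ g → IsGcdMinors A rank g × IsPowerOf p g) ⇔ AllPowersOf p δ
  gcd⇔powers = mk⇔ from-gcd to-gcd
    where
    from-gcd : (Σ ℕ λ g → IsGcdMinors A rank g × IsPowerOf p g) → AllPowersOf p δ
    from-gcd (g , (_ , g-greatest) , (e , refl)) = minor-divisors∣p^e⇒powers p p-prime A∼D isSNF {e} g-greatest
    to-gcd : AllPowersOf p δ → Σ ℕ λ g → IsGcdMinors A rank g × IsPowerOf p g
    to-gcd powers = g , g-gcd , prime-power-divisor p p-prime k g (ℕDiv.∣-trans g∣∏ (ℕDiv.∣-reflexive ∏≡p^k))
      where
      g = proj₁ (gcd-minors A rank)
      g-gcd = proj₂ (gcd-minors A rank)
      leading = snf-leading-minor isSNF rank≤m rank≤n ℕP.≤-refl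
      g∣∏ : g ∣ ∏ (λ i → δ (inject≤ i ℕP.≤-refl))
      g∣∏ = subst (λ z → g ∣ ℤ.∣ z ∣) leading
              (ℤ∣.∣⇒∣ᵤ (minors-∣-∼ A∼D (λ s t → ℤ∣.∣ᵤ⇒∣ {+ g} (proj₁ g-gcd s t)) _ _))
      power = IsPowerOf-∏ p (λ i → δ (inject≤ i ℕP.≤-refl)) (λ i → powers (inject≤ i ℕP.≤-refl))
      k = proj₁ power
      ∏≡p^k = proj₂ power

  conditions : Conclusion p rank A
  conditions =
    (⇔-sym rows⇔powers ⇔-∘ cols⇔powers) ,
    (⇔-sym dual⇔powers ⇔-∘ cols⇔powers) ,
    (⇔-sym elementary-divisors⇔powers ⇔-∘ cols⇔powers) ,
    (⇔-sym gcd⇔powers ⇔-∘ cols⇔powers) ,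
    (⇔-sym inverse⇔powers ⇔-∘ cols⇔powers)

theorem1p3 : (p : ℕ) → Prime p → (m n r : ℕ) → (A : Mat ℤ m n) → HasRank A r →
    (ColsPadicGen p A ⇔ RowsPadicGen p A) ×
    (ColsPadicGen p A ⇔ DualPadic p A) ×
    (ColsPadicGen p A ⇔ (∀ (δ : Fin r → ℕ) → ElemDivisors A δ → ∀ k → IsPowerOf p (δ k))) ×
    (ColsPadicGen p A ⇔ (Σ ℕ λ g → IsGcdMinors A r g × IsPowerOf p g)) ×
    (ColsPadicGen p A ⇔ (Σ (Mat ℚ n m) λ B → (∀ i j → IsPadic p (B i j)) × (((Aℚ A *ℚ B) *ℚ Aℚ A) ≈M Aℚ A)))
theorem1p3 p p-prime m n r A has-rank =
  subst (λ k → Conclusion p k A) (HasRank⇒rank≡ has-rank (smith A)) (conditions p p-prime A (smith A))
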